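{- Let $n\ge 2$ and let $k$ be a positive integer relatively prime to $2n-1$. Then $|M_{2n,k}|\equiv 0 \pmod{(2n-1)^2}$.
   Context: Pointers: for a permutation $\pi\in S_N$ written $[\pi(1)\ \cdots\ \pi(N)]$, entry $k$ has left pointer $(k-1,k)$ and right pointer $(k,k+1)$; the pointer word $W(\pi)$ lists $L(\pi(1))R(\pi(1))\cdots L(\pi(N))R(\pi(N))$ with $(0,1)$ and $(N,N+1)$ removed. Two distinct pointers form a valid pointer context if their occurrences in $W(\pi)$ interleave ($p\ldots q\ldots p\ldots q$ or $q\ldots p\ldots q\ldots p$). Strategic pile: with $X_N=(0\ 1\ \cdots\ N)$, $Y_\pi=(\pi(N)\ \cdots\ \pi(1)\ 0)$ in cycle notation and $C_\pi=Y_\pi\circ X_N$, $\mathrm{SP}(\pi)$ is the set of numbers after $N$ and before $0$ in the cycle of $C_\pi$ containing $0$ and $N$ (empty if different cycles). $\pi\in S_{2n}$ has maximal strategic pile if $|\mathrm{SP}(\pi)|=2n-1$; then $2n$ is immediately followed by $1$, and its contraction is the element of $S_{2n-1}$ obtained by deleting the entry $2n$. $M_{2n,k}$ is the set of contractions of permutations in $S_{2n}$ with maximal strategic pile and exactly $k$ valid pointer contexts. -}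

module Defs where

open import Data.Nat using (ℕ; zero; suc; _+_; _∸_; _≡ᵇ_; _<ᵇ_; _≟_)
open import Data.Bool using (Bool; true; false; if_then_else_; not; _∧_; _∨_)
open import Data.List using (List; []; _∷_; length; filter; filterᵇ; concatMap; map; upTo; last)
open import Data.Nat.ListAction using (sum)
open import Data.List.Properties using (≡-dec)
open import Data.Maybe using (Maybe; just; nothing; fromMaybe)
import Data.Maybe as Maybe
open import Relation.Nullary using (does; ¬_)
open import Relation.Nullary.Decidable using (¬?)
open import Relation.Binary.PropositionalEquality using (_≡_)

-- A permutation π ∈ S_N is represented by its one-line notation
-- [π(1) ... π(N)], a list which is a rearrangement of [1, ..., N].
oneToN : ℕ → List ℕ
oneToN N = map suc (upTo N)

-- Pointers.  The pointer (a, a+1) is encoded by its left endpoint a.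
-- Entry k has left pointer (k-1,k) ↦ k ∸ 1 and right pointer (k,k+1) ↦ k.

-- Pointer word W(π): L(π(1)) R(π(1)) ... L(π(N)) R(π(N)), with the
-- pointers (0,1) and (N,N+1) removed.
pointerWord : List ℕ → List ℕ
pointerWord π =
  filter (λ p → ¬? (p ≟ 0))
    (filter (λ p → ¬? (p ≟ length π))
      (concatMap (λ x → (x ∸ 1) ∷ x ∷ []) π))

interleaveᵇ : List ℕ → ℕ → ℕ → Bool
interleaveᵇ π p q =
  does (≡-dec _≟_ r (p ∷ q ∷ p ∷ q ∷ [])) ∨ does (≡-dec _≟_ r (q ∷ p ∷ q ∷ p ∷ []))
  where
  r : List ℕ
  r = filterᵇ (λ y → does (y ≟ p) ∨ does (y ≟ q)) (pointerWord π)

-- Number of valid pointer contexts: unordered pairs {p,q} of distinct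
-- pointers (p < q; the pointers of W(π) are (1,2), ..., (N-1,N)) whose
-- occurrences interleave.
countContexts : List ℕ → ℕ
countContexts π =
  sum (map (λ p → sum (map (λ q → if interleaveᵇ π p q then 1 else 0)
                            (map (λ j → p + suc j) (upTo (N ∸ 1 ∸ p)))))
           (oneToN (N ∸ 1)))
  where
  N : ℕ
  N = length π

Xcyc : ℕ → ℕ → ℕ
Xcyc N x = if x <ᵇ N then suc x else 0

predIn : ℕ → List ℕ → ℕ → ℕ
predIn prev [] a = a
predIn prev (x ∷ xs) a = if x ≡ᵇ a then prev else predIn x xs a

-- Y_π = (π(N) ... π(1) 0): π(i) ↦ π(i-1), π(1) ↦ 0, 0 ↦ π(N);
-- i.e. the cyclic predecessor in the sequence 0, π(1), ..., π(N).
Ycyc : List ℕ → ℕ → ℕ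
Ycyc π a = predIn (fromMaybe 0 (last π)) (0 ∷ π) a

Ccyc : List ℕ → ℕ → ℕ
Ccyc π x = Ycyc π (Xcyc (length π) x)

walk : ℕ → (ℕ → ℕ) → ℕ → ℕ → Maybe (List ℕ)
walk zero C N x = nothing
walk (suc f) C N x =
  if x ≡ᵇ 0 then just []
  else if x ≡ᵇ N then nothing
  else Maybe.map (x ∷_) (walk f C N (C x))

-- SP(π): the numbers after N and before 0 in the cycle of C_π containing
-- 0 and N (empty if 0 and N lie in different cycles).  Cycles of C_π
-- on {0,...,N} have length ≤ N+1, so fuel N+1 suffices.
strategicPile : List ℕ → List ℕ
strategicPile π = fromMaybe [] (walk (suc N) (Ccyc π) N (Ccyc π N))
  where
  N : ℕ
  N = length π

MaxSP : ℕ → List ℕ → Set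
MaxSP n π = length (strategicPile π) ≡ 2 * n ∸ 1
  where open import Data.Nat using (_*_)

contraction : ℕ → List ℕ → List ℕ
contraction n π = filter (λ x → ¬? (x ≟ 2 * n)) π
  where open import Data.Nat using (_*_)

-- Write m = 2n − 1.  Let π ∈ S_{2n} have maximal strategic pile.  Then 2n stands immediately before 1
-- in π, so π is recovered from its contraction σ by re-inserting 2n.  The walk of C_π from 2n to 0 is
-- 2n ↦ ℓ (the last entry) followed by the orbit of ℓ under C_σ : x ↦ Y_σ(x + 1 mod m) up to its return
-- to ℓ; hence the pile is maximal iff C_σ is a single m-cycle on {1, …, m}.  Likewise W(π) is W(σ) with
-- pointers read modulo m.  Both conditions are thus invariant under rotating σ and under adding 1 mod m
-- to its entries, an action of ℤ_m × ℤ_m on M_{2n,k}.  The action is free: a nontrivial rotation moves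
-- σ, whose entries are distinct; and if adding b ≢ 0 fixes a rotation of σ, the interleaving relation is
-- invariant under adding gcd(b, m), so t = m / gcd(b, m) ≥ 2 divides its full and diagonal sums, hence
-- twice the number k of contexts.  As t divides the odd number m, t ∣ gcd(k, m) = 1, a contradiction.
-- So all orbits have m² elements.

module Submission where

open import Defs
open import Data.Bool using (Bool; true; false; if_then_else_; _∨_; T?)
open import Data.Bool.Properties using (∨-comm)
open import Data.Empty using (⊥; ⊥-elim)
open import Data.List
  using (List; []; _∷_; _++_; length; map; filter; filterᵇ; concatMap; applyUpTo; upTo; last; initLast; _∷ʳ′_;
         cartesianProduct; deduplicate)
open import Data.List.Membership.Propositional using (_∈_; _∉_; find; lose)
open import Data.List.Membership.Propositional.Properties
  using (∈-∃++; ∈-++⁺ˡ; ∈-++⁺ʳ; ∈-map⁺; ∈-map⁻; ∈-filter⁺; ∈-filter⁻; ∈-concatMap⁺; ∈-concatMap⁻; ∈-upTo⁺; ∈-upTo⁻;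
         ∈-deduplicate⁺; ∈-deduplicate⁻; ∈-cartesianProduct⁺; ∈-cartesianProduct⁻)
open import Data.List.Properties
  using (length-++; length-map; length-upTo; filter-notAll; filter-accept; filter-reject; filter-++; filter-all;
         map-++; map-∘; map-cong; map-cong-local; map-id; map-upTo; upTo-∷ʳ; ++-assoc; ++-identityʳ; ∷-injective;
         ∷ʳ-injective; ≡-dec)
open import Data.List.Relation.Binary.Permutation.Propositional
  using (_↭_; ↭-refl; ↭-sym; ↭-trans; ↭-reflexive; prep; swap; ↭⇒↭ₛ; module PermutationReasoning)
open import Data.List.Relation.Binary.Permutation.Propositional.Properties
  using (↭-empty-inv; drop-mid; ∈-resp-↭; ∷↭∷ʳ; ↭-length; map⁺; shift; filter-↭)
open import Data.List.Relation.Binary.Subset.Propositional using (_⊆_)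
open import Data.List.Relation.Unary.All as All using (All; []; _∷_)
import Data.List.Relation.Unary.All.Properties as Allₚ
open import Data.List.Relation.Unary.Any as Any using (Any; here; there; any?)
open import Data.List.Relation.Unary.Unique.Propositional using (Unique; []; _∷_)
import Data.List.Relation.Unary.Unique.Propositional.Properties as Uniqueₚ
import Data.List.Relation.Unary.Unique.DecPropositional.Properties as UniqueDec
open import Data.Maybe using (just; nothing; fromMaybe)
open import Data.Nat
  using (ℕ; zero; suc; _+_; _*_; _∸_; _^_; _≤_; _<_; _≥_; z≤n; s≤s; s≤s⁻¹; _≡ᵇ_; _<ᵇ_; _≟_; _≤?_;
         NonZero; >-nonZero; _/_; _%_)
open import Data.Nat.Coprimality using (Coprime; coprime-divisor)
open import Data.Nat.DivMod using (m≡m%n+[m/n]*n; m%n<n; %-distribˡ-+; m<n⇒m%n≡m; n%n≡0)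
open import Data.Nat.Divisibility using (_∣_; divides; _∣0; ∣-refl; ∣-trans; ∣⇒≤; ∣m∣n⇒∣m+n; ∣m+n∣m⇒∣n; m∣m*n; 0∣⇒≡0)
open import Data.Nat.GCD using (gcd; gcd[m,n]∣m; gcd[m,n]∣n; gcd-GCD; module Bézout)
open import Data.Nat.ListAction using (sum)
open import Data.Nat.ListAction.Properties using (sum-++; sum-↭)
open import Data.Nat.Properties
open import Data.Nat.Solver using (module +-*-Solver)
open import Data.Product using (Σ; _×_; _,_; proj₁; proj₂; ∃-syntax)
open import Data.Sum using (_⊎_; inj₁; inj₂)
open import Function using (_∘_)
open import Function.Bundles using (_⇔_; mk⇔)
open import Relation.Binary.Definitions using (DecidableEquality; tri<; tri≈; tri>)
open import Relation.Binary.PropositionalEquality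
import Relation.Binary.PropositionalEquality as ≡
open import Relation.Nullary using (¬_; Dec; yes; no; does; _×-dec_)
open import Relation.Nullary.Decidable using (¬?)
open import Data.List.Relation.Binary.Permutation.Setoid.Properties (≡.setoid ℕ) using (Unique-resp-↭)
open import Algebra.Properties.CommutativeSemigroup +-commutativeSemigroup using (interchange)

infix 9 _^[_]_

_^[_]_ : {A : Set} → (A → A) → ℕ → A → A
f ^[ zero ] x = x
f ^[ suc i ] x = f (f ^[ i ] x)

module _ {A : Set} (f : A → A) where

  ^[+] : ∀ i j x → f ^[ i + j ] x ≡ f ^[ i ] (f ^[ j ] x)
  ^[+] zero j x = refl
  ^[+] (suc i) j x = cong f (^[+] i j x)

  ^[]-comm : ∀ i x → f (f ^[ i ] x) ≡ f ^[ i ] (f x)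
  ^[]-comm zero x = refl
  ^[]-comm (suc i) x = cong f (^[]-comm i x)

  ^[]-swap : ∀ i j x → f ^[ i ] (f ^[ j ] x) ≡ f ^[ j ] (f ^[ i ] x)
  ^[]-swap i j x = begin
    f ^[ i ] (f ^[ j ] x) ≡⟨ ^[+] i j x ⟨
    f ^[ i + j ] x        ≡⟨ cong (λ k → f ^[ k ] x) (+-comm i j) ⟩
    f ^[ j + i ] x        ≡⟨ ^[+] j i x ⟩
    f ^[ j ] (f ^[ i ] x) ∎
    where open ≡-Reasoning

  ^[*]-fixed : ∀ {n x} → f ^[ n ] x ≡ x → ∀ q → f ^[ q * n ] x ≡ x
  ^[*]-fixed fx zero = refl
  ^[*]-fixed {n} {x} fx (suc q) =
    trans (^[+] n (q * n) x) (trans (cong (f ^[ n ]_) (^[*]-fixed fx q)) fx)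

  ^[%]-fixed : ∀ {n x} .{{_ : NonZero n}} → f ^[ n ] x ≡ x → ∀ a → f ^[ a ] x ≡ f ^[ a % n ] x
  ^[%]-fixed {n} {x} fx a = begin
    f ^[ a ] x                                ≡⟨ cong (λ k → f ^[ k ] x) (m≡m%n+[m/n]*n a n) ⟩
    f ^[ a % n + (a / n) * n ] x              ≡⟨ ^[+] (a % n) ((a / n) * n) x ⟩
    f ^[ a % n ] (f ^[ (a / n) * n ] x)       ≡⟨ cong (f ^[ a % n ]_) (^[*]-fixed fx (a / n)) ⟩
    f ^[ a % n ] x                            ∎
    where open ≡-Reasoning

HasExactPeriod : {A : Set} → (A → A) → ℕ → A → Set
HasExactPeriod f m y = (∀ j → 0 < j → j < m → f ^[ j ] y ≢ y) × f ^[ m ] y ≡ y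

module IterateOn {A : Set} (P : A → Set) (f : A → A)
  (closed : ∀ {x} → P x → P (f x))
  (injective : ∀ {x y} → P x → P y → f x ≡ f y → x ≡ y) where

  ^[]-closed : ∀ i {x} → P x → P (f ^[ i ] x)
  ^[]-closed zero px = px
  ^[]-closed (suc i) px = closed (^[]-closed i px)

  ^[]-injective : ∀ i {x y} → P x → P y → f ^[ i ] x ≡ f ^[ i ] y → x ≡ y
  ^[]-injective zero px py e = e
  ^[]-injective (suc i) px py e =
    ^[]-injective i px py (injective (^[]-closed i px) (^[]-closed i py) e)

  ^[]-return : ∀ {i j x} → P x → i ≤ j → f ^[ i ] x ≡ f ^[ j ] x → f ^[ j ∸ i ] x ≡ x
  ^[]-return {i} {j} {x} px i≤j e = ^[]-injective i (^[]-closed (j ∸ i) px) px (begin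
    f ^[ i ] (f ^[ j ∸ i ] x) ≡⟨ ^[]-swap f i (j ∸ i) x ⟩
    f ^[ j ∸ i ] (f ^[ i ] x) ≡⟨ ^[+] f (j ∸ i) i x ⟨
    f ^[ j ∸ i + i ] x        ≡⟨ cong (λ k → f ^[ k ] x) (m∸n+n≡m i≤j) ⟩
    f ^[ j ] x                ≡⟨ e ⟨
    f ^[ i ] x                ∎)
    where open ≡-Reasoning

  ^[]-conjugate : ∀ {B : Set} (g : B → B) (h : A → B) → (∀ {x} → P x → g (h x) ≡ h (f x)) →
    ∀ i {x} → P x → g ^[ i ] (h x) ≡ h (f ^[ i ] x)
  ^[]-conjugate g h commutes zero _ = refl
  ^[]-conjugate g h commutes (suc i) px =
    trans (cong g (^[]-conjugate g h commutes i px)) (commutes (^[]-closed i px))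

module _ {A : Set} where

  Unique-⊆⇒length≤ : {xs ys : List A} → Unique xs → xs ⊆ ys → length xs ≤ length ys
  Unique-⊆⇒length≤ {[]} _ _ = z≤n
  Unique-⊆⇒length≤ {x ∷ xs} (x∉xs ∷ xs!) xs⊆ys with as , bs , refl ← ∈-∃++ (xs⊆ys (here refl)) =
    begin
      suc (length xs)          ≤⟨ s≤s (Unique-⊆⇒length≤ xs! xs⊆as++bs) ⟩
      suc (length (as ++ bs))  ≡⟨ cong suc (length-++ as) ⟩
      suc (length as + length bs) ≡⟨ +-suc (length as) (length bs) ⟨
      length as + length (x ∷ bs) ≡⟨ length-++ as ⟨
      length (as ++ x ∷ bs)    ∎
    where
    open ≤-Reasoning
    drop-x : ∀ as {y} → y ∈ as ++ x ∷ bs → x ≢ y → y ∈ as ++ bs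
    drop-x [] (here refl) x≢y = ⊥-elim (x≢y refl)
    drop-x [] (there y∈) _ = y∈
    drop-x (a ∷ as) (here refl) _ = here refl
    drop-x (a ∷ as) (there y∈) x≢y = there (drop-x as y∈ x≢y)
    xs⊆as++bs : xs ⊆ as ++ bs
    xs⊆as++bs y∈xs = drop-x as (xs⊆ys (there y∈xs)) (All.lookup x∉xs y∈xs)

  Unique-⊆-length⇒⊇ : DecidableEquality A → {xs ys : List A} → Unique xs → xs ⊆ ys →
    length ys ≤ length xs → ys ⊆ xs
  Unique-⊆-length⇒⊇ _≟_ {xs} {ys} xs! xs⊆ys ys≤xs {y} y∈ys with any? (y ≟_) xs
  ... | yes y∈xs = y∈xs
  ... | no y∉xs = ⊥-elim (<⇒≱ (≤-<-trans (Unique-⊆⇒length≤ xs! xs⊆ys-y) ys-y<ys) ys≤xs)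
    where
    y≢? : ∀ z → Dec (¬ y ≡ z)
    y≢? z = ¬? (y ≟ z)
    xs⊆ys-y : xs ⊆ filter y≢? ys
    xs⊆ys-y {z} z∈xs = ∈-filter⁺ y≢? (xs⊆ys z∈xs) λ { refl → y∉xs z∈xs }
    ys-y<ys : length (filter y≢? ys) < length ys
    ys-y<ys = filter-notAll y≢? ys (Any.map (λ y≡z y≢z → y≢z y≡z) y∈ys)

  Unique-mapOn⁺ : {B : Set} {f : A → B} {xs : List A} →
    (∀ {x y} → x ∈ xs → y ∈ xs → f x ≡ f y → x ≡ y) → Unique xs → Unique (map f xs)
  Unique-mapOn⁺ {xs = []} _ [] = []
  Unique-mapOn⁺ {xs = x ∷ xs} inj (x∉xs ∷ xs!) =
    All.tabulate (λ fy∈ e → let y , y∈ , fy≡ = ∈-map⁻ _ fy∈ in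
                   All.lookup x∉xs y∈ (inj (here refl) (there y∈) (trans e fy≡)))
    ∷ Unique-mapOn⁺ (λ x∈ y∈ → inj (there x∈) (there y∈)) xs!

  Unique-middle : ∀ {xs ys} {x : A} → Unique (xs ++ x ∷ ys) → All (_≢ x) xs × All (_≢ x) ys
  Unique-middle {[]} (x∉ ∷ _) = [] , All.map (_∘ sym) x∉
  Unique-middle {y ∷ xs} (y∉ ∷ xs-x-ys!) with xs≢x , ys≢x ← Unique-middle {xs} xs-x-ys! =
    (All.lookup y∉ (∈-++⁺ʳ xs (here refl)) ∷ xs≢x) , ys≢x

  length-++-∷ : ∀ xs {x : A} ys → length (xs ++ x ∷ ys) ≡ suc (length (xs ++ ys))
  length-++-∷ xs {x} ys = begin
    length (xs ++ x ∷ ys)         ≡⟨ length-++ xs ⟩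
    length xs + suc (length ys)   ≡⟨ +-suc (length xs) (length ys) ⟩
    suc (length xs + length ys)   ≡⟨ cong suc (length-++ xs) ⟨
    suc (length (xs ++ ys))       ∎
    where open ≡-Reasoning

  length-filter-complement : {P : A → Set} (P? : ∀ x → Dec (P x)) (xs : List A) →
    length (filter P? xs) + length (filter (λ x → ¬? (P? x)) xs) ≡ length xs
  length-filter-complement P? [] = refl
  length-filter-complement P? (x ∷ xs) with P? x
  ... | yes _ = cong suc (length-filter-complement P? xs)
  ... | no _ = trans (+-suc _ _) (cong suc (length-filter-complement P? xs))

length-cartesianProduct : ∀ {A B : Set} (xs : List A) (ys : List B) →
  length (cartesianProduct xs ys) ≡ length xs * length ys
length-cartesianProduct [] ys = refl
length-cartesianProduct (x ∷ xs) ys =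
  trans (length-++ (map (x ,_) ys)) (cong₂ _+_ (length-map _ ys) (length-cartesianProduct xs ys))

module _ {A : Set} where

  rotate : List A → List A
  rotate [] = []
  rotate (x ∷ xs) = xs ++ x ∷ []

  rotate-↭ : (l : List A) → rotate l ↭ l
  rotate-↭ [] = ↭-refl
  rotate-↭ (x ∷ l) = ↭-sym (∷↭∷ʳ x l)

  rotate^[length]-++ : (xs ys : List A) → rotate ^[ length xs ] (xs ++ ys) ≡ ys ++ xs
  rotate^[length]-++ [] ys = sym (++-identityʳ ys)
  rotate^[length]-++ (x ∷ xs) ys = begin
    rotate (rotate ^[ length xs ] (x ∷ xs ++ ys)) ≡⟨ ^[]-comm rotate (length xs) (x ∷ xs ++ ys) ⟩
    rotate ^[ length xs ] (rotate (x ∷ xs ++ ys)) ≡⟨ cong (rotate ^[ length xs ]_) (++-assoc xs ys (x ∷ [])) ⟩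
    rotate ^[ length xs ] (xs ++ ys ++ x ∷ [])    ≡⟨ rotate^[length]-++ xs (ys ++ x ∷ []) ⟩
    (ys ++ x ∷ []) ++ xs                          ≡⟨ ++-assoc ys (x ∷ []) xs ⟩
    ys ++ x ∷ xs                                  ∎
    where open ≡-Reasoning

  rotate^[length] : (l : List A) → rotate ^[ length l ] l ≡ l
  rotate^[length] l = trans (cong (rotate ^[ length l ]_) (sym (++-identityʳ l))) (rotate^[length]-++ l [])

  private
    splitAt-length : ∀ a (l : List A) → a ≤ length l → ∃[ xs ] ∃[ ys ] l ≡ xs ++ ys × length xs ≡ a
    splitAt-length zero l _ = [] , l , refl , refl
    splitAt-length (suc a) (x ∷ l) (s≤s a≤l) with xs , ys , refl , refl ← splitAt-length a l a≤l =
      x ∷ xs , ys , refl , refl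

    Unique-++-disjoint : ∀ xs {ys} {x : A} → Unique (xs ++ ys) → x ∈ xs → x ∈ ys → ⊥
    Unique-++-disjoint (z ∷ xs) (z∉ ∷ _) (here refl) x∈ys = All.lookup z∉ (∈-++⁺ʳ xs x∈ys) refl
    Unique-++-disjoint (z ∷ xs) (_ ∷ xs!) (there x∈xs) x∈ys = Unique-++-disjoint xs xs! x∈xs x∈ys

  rotate^[]-moves : ∀ {a} {l : List A} → Unique l → 0 < a → a < length l → rotate ^[ a ] l ≢ l
  rotate^[]-moves {a} {l} l! 0<a a<l rl≡l
    with splitAt-length a l (<⇒≤ a<l)
  ... | [] , _ , refl , refl = <-irrefl refl 0<a
  ... | x ∷ xs , [] , refl , refl = <-irrefl (sym (cong length (++-identityʳ (x ∷ xs)))) a<l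
  ... | x ∷ xs , y ∷ ys , refl , refl = Unique-++-disjoint (x ∷ xs) l! (here refl) (here (sym y≡x))
    where
    y≡x : y ≡ x
    y≡x = proj₁ (∷-injective (trans (sym (rotate^[length]-++ (x ∷ xs) (y ∷ ys))) rl≡l))

rotate-map : ∀ {A B : Set} (g : A → B) (l : List A) → rotate (map g l) ≡ map g (rotate l)
rotate-map g [] = refl
rotate-map g (x ∷ l) = sym (map-++ g l (x ∷ []))

rotate^[]-map : ∀ {A B : Set} a (g : A → B) (l : List A) → rotate ^[ a ] (map g l) ≡ map g (rotate ^[ a ] l)
rotate^[]-map zero g l = refl
rotate^[]-map (suc a) g l = trans (cong rotate (rotate^[]-map a g l)) (rotate-map g (rotate ^[ a ] l))

module _ {A : Set} where

  insertions : A → List A → List (List A)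
  insertions x [] = (x ∷ []) ∷ []
  insertions x (y ∷ ys) = (x ∷ y ∷ ys) ∷ map (y ∷_) (insertions x ys)

  permutations : List A → List (List A)
  permutations [] = [] ∷ []
  permutations (x ∷ xs) = concatMap (insertions x) (permutations xs)

  ∈-insertions⁻ : ∀ x ys {zs} → zs ∈ insertions x ys → zs ↭ x ∷ ys
  ∈-insertions⁻ x [] (here refl) = ↭-refl
  ∈-insertions⁻ x (y ∷ ys) (here refl) = ↭-refl
  ∈-insertions⁻ x (y ∷ ys) (there zs∈) with ws , ws∈ , refl ← ∈-map⁻ _ zs∈ =
    ↭-trans (prep y (∈-insertions⁻ x ys ws∈)) (swap y x ↭-refl)

  ∈-insertions⁺ : ∀ x as bs → as ++ x ∷ bs ∈ insertions x (as ++ bs)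
  ∈-insertions⁺ x [] [] = here refl
  ∈-insertions⁺ x [] (b ∷ bs) = here refl
  ∈-insertions⁺ x (a ∷ as) bs = there (∈-map⁺ (a ∷_) (∈-insertions⁺ x as bs))

  ∈-permutations⁻ : ∀ xs {zs} → zs ∈ permutations xs → zs ↭ xs
  ∈-permutations⁻ [] (here refl) = ↭-refl
  ∈-permutations⁻ (x ∷ xs) zs∈ with ws , ws∈ , zs∈′ ← find (∈-concatMap⁻ (insertions x) zs∈) =
    ↭-trans (∈-insertions⁻ x ws zs∈′) (prep x (∈-permutations⁻ xs ws∈))

  ∈-permutations⁺ : ∀ xs {zs} → zs ↭ xs → zs ∈ permutations xs
  ∈-permutations⁺ [] p rewrite ↭-empty-inv p = here refl
  ∈-permutations⁺ (x ∷ xs) p with as , bs , refl ← ∈-∃++ (∈-resp-↭ (↭-sym p) (here refl)) =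
    ∈-concatMap⁺ (insertions x)
      (lose (∈-permutations⁺ xs (drop-mid as [] p)) (∈-insertions⁺ x as bs))

-- Free actions

module FreeAction {A E : Set} (_≟_ : DecidableEquality A) (es : List E) (act : E → A → A)
  (P : A → Set)
  (identity : ∀ {x} → P x → ∃[ e ] e ∈ es × act e x ≡ x)
  (inverse : ∀ {x e} → P x → e ∈ es → ∃[ e′ ] e′ ∈ es × act e′ (act e x) ≡ x)
  (compose : ∀ {x e e′} → P x → e ∈ es → e′ ∈ es → ∃[ e″ ] e″ ∈ es × act e′ (act e x) ≡ act e″ x)
  (free : ∀ {x} → P x → Unique (map (λ e → act e x) es)) where

  orbit : A → List A
  orbit x = map (λ e → act e x) es

  private
    ∈orbit? : ∀ x y → Dec (y ∈ orbit x)
    ∈orbit? x y = any? (y ≟_) (orbit x)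

    x∈orbit : ∀ {x} → P x → x ∈ orbit x
    x∈orbit px with e , e∈ , ex≡x ← identity px = subst (_∈ orbit _) ex≡x (∈-map⁺ _ e∈)

    orbit-closed : ∀ {x y e} → P x → P y → e ∈ es → act e y ∈ orbit x → y ∈ orbit x
    orbit-closed {x} {y} {e} px py e∈ ey∈
      with e₁ , e₁∈ , ey≡e₁x ← ∈-map⁻ _ ey∈ | e′ , e′∈ , e′ey≡y ← inverse py e∈
      with e₂ , e₂∈ , e′e₁x≡e₂x ← compose px e₁∈ e′∈ =
      subst (_∈ orbit x) (trans (sym e′e₁x≡e₂x) (trans (cong (act e′) (sym ey≡e₁x)) e′ey≡y))
        (∈-map⁺ _ e₂∈)

    length-orbit : ∀ {x} L → P x → Unique L → orbit x ⊆ L → length (filter (∈orbit? x) L) ≡ length es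
    length-orbit {x} L px L! orbit⊆L = trans (≤-antisym
      (Unique-⊆⇒length≤ (Uniqueₚ.filter⁺ (∈orbit? x) L!) (λ y∈ → proj₂ (∈-filter⁻ (∈orbit? x) {xs = L} y∈)))
      (Unique-⊆⇒length≤ (free px) (λ y∈ → ∈-filter⁺ (∈orbit? x) (orbit⊆L y∈) y∈))) (length-map _ es)

    divides-with-fuel : (n : ℕ) (Q : A → Set) → (∀ {x} → Q x → P x) →
      (∀ {x e} → Q x → e ∈ es → Q (act e x)) →
      (L : List A) → length L ≤ n → Unique L → (∀ {x} → x ∈ L → Q x) → (∀ {x} → Q x → x ∈ L) →
      length es ∣ length L
    divides-with-fuel _ Q Q⇒P Q-closed [] _ _ _ _ = _ ∣0
    divides-with-fuel (suc n) Q Q⇒P Q-closed L@(x ∷ L′) (s≤s L′≤n) L! L⊆Q Q⊆L =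
      subst (length es ∣_) length-split (∣m∣n⇒∣m+n outside-divisible ∣-refl)
      where
      px : P x
      px = Q⇒P (L⊆Q (here refl))
      out? : ∀ y → Dec (y ∉ orbit x)
      out? y = ¬? (∈orbit? x y)
      outside : List A
      outside = filter out? L
      Q′ : A → Set
      Q′ y = Q y × y ∉ orbit x
      Q′-closed : ∀ {y e} → Q′ y → e ∈ es → Q′ (act e y)
      Q′-closed (qy , y∉) e∈ = Q-closed qy e∈ , λ ey∈ → y∉ (orbit-closed px (Q⇒P qy) e∈ ey∈)
      outside⊆L′ : outside ⊆ L′
      outside⊆L′ y∈ with ∈-filter⁻ out? {xs = L} y∈
      ... | here refl , x∉ = ⊥-elim (x∉ (x∈orbit px))
      ... | there y∈L′ , _ = y∈L′
      outside! : Unique outside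
      outside! = Uniqueₚ.filter⁺ out? L!
      outside-divisible : length es ∣ length outside
      outside-divisible = divides-with-fuel n Q′ (λ q → Q⇒P (proj₁ q)) Q′-closed outside
        (≤-trans (Unique-⊆⇒length≤ outside! outside⊆L′) L′≤n) outside!
        (λ y∈ → let y∈L , y∉ = ∈-filter⁻ out? {xs = L} y∈ in L⊆Q y∈L , y∉)
        (λ (qy , y∉) → ∈-filter⁺ out? (Q⊆L qy) y∉)
      orbit⊆L : orbit x ⊆ L
      orbit⊆L y∈ with e , e∈ , refl ← ∈-map⁻ _ y∈ = Q⊆L (Q-closed (L⊆Q (here refl)) e∈)
      length-split : length outside + length es ≡ length L
      length-split = trans (+-comm (length outside) (length es))
        (trans (cong (_+ length outside) (sym (length-orbit L px L! orbit⊆L)))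
               (length-filter-complement (∈orbit? x) L))

  length-divisible : (Q : A → Set) → (∀ {x} → Q x → P x) → (∀ {x e} → Q x → e ∈ es → Q (act e x)) →
    (L : List A) → Unique L → (∀ {x} → x ∈ L → Q x) → (∀ {x} → Q x → x ∈ L) → length es ∣ length L
  length-divisible Q Q⇒P Q-closed L = divides-with-fuel (length L) Q Q⇒P Q-closed L ≤-refl

≡ᵇ-refl : ∀ x → (x ≡ᵇ x) ≡ true
≡ᵇ-refl zero = refl
≡ᵇ-refl (suc x) = ≡ᵇ-refl x

≢⇒≡ᵇ-false : ∀ {x y} → x ≢ y → (x ≡ᵇ y) ≡ false
≢⇒≡ᵇ-false {zero} {zero} x≢y = ⊥-elim (x≢y refl)
≢⇒≡ᵇ-false {zero} {suc y} _ = refl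
≢⇒≡ᵇ-false {suc x} {zero} _ = refl
≢⇒≡ᵇ-false {suc x} {suc y} x≢y = ≢⇒≡ᵇ-false (x≢y ∘ cong suc)

<⇒<ᵇ-true : ∀ {x y} → x < y → (x <ᵇ y) ≡ true
<⇒<ᵇ-true {zero} {suc y} _ = refl
<⇒<ᵇ-true {suc x} {suc y} (s≤s x<y) = <⇒<ᵇ-true x<y

<ᵇ-irrefl : ∀ x → (x <ᵇ x) ≡ false
<ᵇ-irrefl zero = refl
<ᵇ-irrefl (suc x) = <ᵇ-irrefl x

¬2∣⇒coprime-2 : ∀ {t} → ¬ 2 ∣ t → Coprime t 2
¬2∣⇒coprime-2 ¬2∣t {zero} (_ , 0∣2) with () ← 0∣⇒≡0 0∣2
¬2∣⇒coprime-2 ¬2∣t {1} _ = refl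
¬2∣⇒coprime-2 ¬2∣t {2} (2∣t , _) = ⊥-elim (¬2∣t 2∣t)
¬2∣⇒coprime-2 ¬2∣t {suc (suc (suc d))} (_ , d∣2) with s≤s (s≤s ()) ← ∣⇒≤ d∣2

[m∸a′+a]%m≡0⇒a≡a′ : ∀ {m a a′} .{{_ : NonZero m}} → a < m → a′ < m → (m ∸ a′ + a) % m ≡ 0 → a ≡ a′
[m∸a′+a]%m≡0⇒a≡a′ {m} {a} {a′} a<m a′<m e with (m ∸ a′ + a) / m | m≡m%n+[m/n]*n (m ∸ a′ + a) m
... | zero | eq = ⊥-elim (<-irrefl (sym (trans eq (cong (_+ 0) e))) (≤-trans (m<n⇒0<n∸m a′<m) (m≤m+n (m ∸ a′) a)))
... | suc zero | eq = +-cancelˡ-≡ (m ∸ a′) a a′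
      (trans (trans eq (trans (cong (_+ (m + 0)) e) (+-identityʳ m))) (sym (m∸n+n≡m (<⇒≤ a′<m))))
... | suc (suc q) | eq = ⊥-elim (<-irrefl refl (<-≤-trans (+-mono-≤-< (m∸n≤m m a′) a<m) 2m≤))
  where
  2m≤ : m + m ≤ m ∸ a′ + a
  2m≤ = subst (m + m ≤_) (sym (trans eq (cong (_+ (m + (m + q * m))) e))) (+-monoʳ-≤ m (m≤m+n m (q * m)))

[x%m+a]%m≡[x+a]%m : ∀ {m} .{{_ : NonZero m}} x {a} → a < m → (x % m + a) % m ≡ (x + a) % m
[x%m+a]%m≡[x+a]%m {m} x {a} a<m =
  trans (cong (λ z → (x % m + z) % m) (sym (m<n⇒m%n≡m a<m))) (sym (%-distribˡ-+ x a m))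

gcd-cofactor-≥2 : ∀ {b m t} → 0 < b → b < m → m ≡ t * gcd b m → 2 ≤ t
gcd-cofactor-≥2 {b} {m} {zero} _ b<m m≡0 = ⊥-elim (<-irrefl (sym m≡0) (≤-<-trans z≤n b<m))
gcd-cofactor-≥2 {b} {m} {suc zero} 0<b b<m m≡d =
  ⊥-elim (<-irrefl (trans (sym (+-identityʳ _)) (sym m≡d)) (≤-<-trans (∣⇒≤ {{>-nonZero 0<b}} (gcd[m,n]∣m b m)) b<m))
gcd-cofactor-≥2 {t = suc (suc _)} _ _ _ = s≤s (s≤s z≤n)

sumBelow : ℕ → (ℕ → ℕ) → ℕ
sumBelow zero g = 0
sumBelow (suc n) g = g 0 + sumBelow n (g ∘ suc)

sumBelow-cong : ∀ n {g h : ℕ → ℕ} → (∀ i → i < n → g i ≡ h i) → sumBelow n g ≡ sumBelow n h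
sumBelow-cong zero _ = refl
sumBelow-cong (suc n) g≡h = cong₂ _+_ (g≡h 0 (s≤s z≤n)) (sumBelow-cong n (λ i i<n → g≡h (suc i) (s≤s i<n)))

sumBelow-+ : ∀ k l (g : ℕ → ℕ) → sumBelow (k + l) g ≡ sumBelow k g + sumBelow l (λ i → g (k + i))
sumBelow-+ zero l g = refl
sumBelow-+ (suc k) l g = trans (cong (g 0 +_) (sumBelow-+ k l (g ∘ suc))) (sym (+-assoc (g 0) _ _))

sumBelow-periodic : ∀ d t (g : ℕ → ℕ) → (∀ i → i + d < t * d → g (i + d) ≡ g i) →
  sumBelow (t * d) g ≡ t * sumBelow d g
sumBelow-periodic d zero g _ = refl
sumBelow-periodic d (suc t) g period = begin
  sumBelow (d + t * d) g                        ≡⟨ sumBelow-+ d (t * d) g ⟩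
  sumBelow d g + sumBelow (t * d) (λ i → g (d + i)) ≡⟨ cong (sumBelow d g +_) (sumBelow-cong (t * d) shifted) ⟩
  sumBelow d g + sumBelow (t * d) g             ≡⟨ cong (sumBelow d g +_) (sumBelow-periodic d t g period′) ⟩
  sumBelow d g + t * sumBelow d g               ∎
  where
  open ≡-Reasoning
  shifted : ∀ i → i < t * d → g (d + i) ≡ g i
  shifted i i<td = trans (cong g (+-comm d i)) (period i (subst (_< d + t * d) (+-comm d i) (+-monoʳ-< d i<td)))
  period′ : ∀ i → i + d < t * d → g (i + d) ≡ g i
  period′ i lt = period i (≤-trans lt (m≤n+m (t * d) d))

sum-applyUpTo : (h f : ℕ → ℕ) (n : ℕ) → sum (map h (applyUpTo f n)) ≡ sumBelow n (h ∘ f)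
sum-applyUpTo h f zero = refl
sum-applyUpTo h f (suc n) = cong (h (f 0) +_) (sum-applyUpTo h (f ∘ suc) n)

InRange : ℕ → ℕ → Set
InRange m x = 1 ≤ x × x ≤ m

oneToN-suc : ∀ m → oneToN (suc m) ≡ oneToN m ++ suc m ∷ []
oneToN-suc m = trans (cong (map suc) (sym (upTo-∷ʳ m))) (map-++ suc (upTo m) (m ∷ []))

∈-oneToN⁻ : ∀ {m x} → x ∈ oneToN m → InRange m x
∈-oneToN⁻ x∈ with j , j∈ , refl ← ∈-map⁻ suc x∈ = s≤s z≤n , ∈-upTo⁻ j∈

∈-oneToN⁺ : ∀ {m x} → InRange m x → x ∈ oneToN m
∈-oneToN⁺ {x = suc x} (s≤s z≤n , x<m) = ∈-map⁺ suc (∈-upTo⁺ x<m)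

length-oneToN : ∀ m → length (oneToN m) ≡ m
length-oneToN m = trans (length-map suc (upTo m)) (length-upTo m)

oneToN-cons : ∀ m → oneToN (suc m) ≡ 1 ∷ map suc (oneToN m)
oneToN-cons m = cong (λ xs → 1 ∷ map suc xs) (sym (map-upTo suc m))

oneToN! : ∀ m → Unique (oneToN m)
oneToN! m = Uniqueₚ.map⁺ suc-injective (Uniqueₚ.upTo⁺ m)

record IsPerm (m : ℕ) (σ : List ℕ) : Set where
  field
    unique : Unique σ
    bounded : ∀ {x} → x ∈ σ → InRange m x
    complete : ∀ {x} → InRange m x → x ∈ σ
    length≡ : length σ ≡ m

open IsPerm public

↭⇒IsPerm : ∀ {m σ} → σ ↭ oneToN m → IsPerm m σ
↭⇒IsPerm {m} σ↭ = record
  { unique = Unique-resp-↭ (↭⇒↭ₛ (↭-sym σ↭)) (oneToN! m)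
  ; bounded = ∈-oneToN⁻ ∘ ∈-resp-↭ σ↭
  ; complete = ∈-resp-↭ (↭-sym σ↭) ∘ ∈-oneToN⁺
  ; length≡ = trans (↭-length σ↭) (length-oneToN m)
  }

cyclicSuc : ℕ → ℕ → ℕ
cyclicSuc m x = if x ≡ᵇ m then 1 else suc x

module _ {m : ℕ} where

  cyclicSuc-top : cyclicSuc m m ≡ 1
  cyclicSuc-top rewrite ≡ᵇ-refl m = refl

  cyclicSuc-≢ : ∀ {x} → x ≢ m → cyclicSuc m x ≡ suc x
  cyclicSuc-≢ x≢m rewrite ≢⇒≡ᵇ-false x≢m = refl

  cyclicSuc-inRange : ∀ {x} → InRange m x → InRange m (cyclicSuc m x)
  cyclicSuc-inRange {x} (1≤x , x≤m) with x ≟ m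
  ... | yes refl rewrite cyclicSuc-top = s≤s z≤n , ≤-trans 1≤x x≤m
  ... | no x≢m rewrite cyclicSuc-≢ x≢m = s≤s z≤n , ≤∧≢⇒< x≤m x≢m

  cyclicSuc-injective : ∀ {x y} → InRange m x → InRange m y → cyclicSuc m x ≡ cyclicSuc m y → x ≡ y
  cyclicSuc-injective {x} {y} (1≤x , _) (1≤y , _) e with x ≟ m | y ≟ m
  ... | yes refl | yes refl = refl
  ... | yes refl | no y≢m rewrite cyclicSuc-top | cyclicSuc-≢ y≢m = ⊥-elim (<-irrefl (suc-injective e) 1≤y)
  ... | no x≢m | yes refl rewrite cyclicSuc-top | cyclicSuc-≢ x≢m = ⊥-elim (<-irrefl (sym (suc-injective e)) 1≤x)
  ... | no x≢m | no y≢m rewrite cyclicSuc-≢ x≢m | cyclicSuc-≢ y≢m = suc-injective e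

  cyclicSuc-surjective : ∀ {y} → InRange m y → ∃[ x ] InRange m x × cyclicSuc m x ≡ y
  cyclicSuc-surjective {suc zero} (_ , 1≤m) = m , (1≤m , ≤-refl) , cyclicSuc-top
  cyclicSuc-surjective {suc (suc y)} (_ , y<m) =
    suc y , (s≤s z≤n , <⇒≤ y<m) , cyclicSuc-≢ (λ e → <-irrefl e y<m)

  cyclicSuc^[]-+ : ∀ {x} d → x + d ≤ m → cyclicSuc m ^[ d ] x ≡ x + d
  cyclicSuc^[]-+ {x} zero _ = sym (+-identityʳ x)
  cyclicSuc^[]-+ {x} (suc d) x+1+d≤m = begin
    cyclicSuc m (cyclicSuc m ^[ d ] x) ≡⟨ cong (cyclicSuc m) (cyclicSuc^[]-+ d (<⇒≤ x+d<m)) ⟩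
    cyclicSuc m (x + d)                ≡⟨ cyclicSuc-≢ (λ e → <-irrefl e x+d<m) ⟩
    suc (x + d)                        ≡⟨ +-suc x d ⟨
    x + suc d                          ∎
    where
    open ≡-Reasoning
    x+d<m : x + d < m
    x+d<m = subst (_≤ m) (+-suc x d) x+1+d≤m

  cyclicSuc^[m] : ∀ {x} → InRange m x → cyclicSuc m ^[ m ] x ≡ x
  cyclicSuc^[m] {suc x} (s≤s z≤n , x<m) = begin
    cyclicSuc m ^[ m ] (suc x)                               ≡⟨ cong (λ k → cyclicSuc m ^[ k ] suc x) m≡x+1+r ⟩
    cyclicSuc m ^[ x + suc r ] (suc x)                       ≡⟨ ^[+] (cyclicSuc m) x (suc r) (suc x) ⟩
    cyclicSuc m ^[ x ] (cyclicSuc m (cyclicSuc m ^[ r ] suc x))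
      ≡⟨ cong (λ z → cyclicSuc m ^[ x ] cyclicSuc m z) (cyclicSuc^[]-+ r (≤-reflexive 1+x+r≡m)) ⟩
    cyclicSuc m ^[ x ] (cyclicSuc m (suc x + r))             ≡⟨ cong (λ z → cyclicSuc m ^[ x ] cyclicSuc m z) 1+x+r≡m ⟩
    cyclicSuc m ^[ x ] (cyclicSuc m m)                       ≡⟨ cong (cyclicSuc m ^[ x ]_) cyclicSuc-top ⟩
    cyclicSuc m ^[ x ] 1                                     ≡⟨ cyclicSuc^[]-+ x x<m ⟩
    suc x                                                    ∎
    where
    open ≡-Reasoning
    r = m ∸ suc x
    1+x+r≡m : suc x + r ≡ m
    1+x+r≡m = m+[n∸m]≡n x<m
    m≡x+1+r : m ≡ x + suc r
    m≡x+1+r = trans (sym 1+x+r≡m) (sym (+-suc x r))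

module CyclicSuc (m : ℕ) = IterateOn (InRange m) (cyclicSuc m) cyclicSuc-inRange cyclicSuc-injective

map-cyclicSuc-↭ : ∀ m → map (cyclicSuc m) (oneToN m) ↭ oneToN m
map-cyclicSuc-↭ zero = ↭-refl
map-cyclicSuc-↭ (suc k) = begin
  map (cyclicSuc (suc k)) (oneToN (suc k))  ≡⟨ cong (map (cyclicSuc (suc k))) (oneToN-suc k) ⟩
  map (cyclicSuc (suc k)) (oneToN k ++ suc k ∷ [])
    ≡⟨ map-++ (cyclicSuc (suc k)) (oneToN k) (suc k ∷ []) ⟩
  map (cyclicSuc (suc k)) (oneToN k) ++ cyclicSuc (suc k) (suc k) ∷ []
    ≡⟨ cong₂ (λ xs y → xs ++ y ∷ []) below-top cyclicSuc-top ⟩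
  map suc (oneToN k) ++ 1 ∷ []              ↭⟨ ∷↭∷ʳ 1 (map suc (oneToN k)) ⟨
  1 ∷ map suc (oneToN k)                    ≡⟨ oneToN-cons k ⟨
  oneToN (suc k)                            ∎
  where
  open PermutationReasoning
  below-top : map (cyclicSuc (suc k)) (oneToN k) ≡ map suc (oneToN k)
  below-top = map-cong-local (All.tabulate λ x∈ →
    cyclicSuc-≢ (λ { refl → <-irrefl refl (proj₂ (∈-oneToN⁻ x∈)) }))

map-cyclicSuc^[]-↭ : ∀ m b → map (cyclicSuc m ^[ b ]_) (oneToN m) ↭ oneToN m
map-cyclicSuc^[]-↭ m zero = ↭-reflexive (map-id (oneToN m))
map-cyclicSuc^[]-↭ m (suc b) = ↭-trans (↭-reflexive (map-∘ (oneToN m)))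
  (↭-trans (map⁺ (cyclicSuc m) (map-cyclicSuc^[]-↭ m b)) (map-cyclicSuc-↭ m))

injection-covers : ∀ {m} (g : ℕ → ℕ) → (∀ {i j} → i < m → j < m → g i ≡ g j → i ≡ j) →
  (∀ {i} → i < m → InRange m (g i)) → ∀ {y} → InRange m y → ∃[ i ] i < m × g i ≡ y
injection-covers {m} g g-injective g-inRange y∈ =
  from-image (Unique-⊆-length⇒⊇ _≟_ image! image⊆ length≤ (∈-oneToN⁺ y∈))
  where
  image! : Unique (map g (upTo m))
  image! = Unique-mapOn⁺ (λ i∈ j∈ → g-injective (∈-upTo⁻ i∈) (∈-upTo⁻ j∈)) (Uniqueₚ.upTo⁺ m)
  image⊆ : map g (upTo m) ⊆ oneToN m
  image⊆ gi∈ with i , i∈ , refl ← ∈-map⁻ g gi∈ = ∈-oneToN⁺ (g-inRange (∈-upTo⁻ i∈))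
  length≤ : length (oneToN m) ≤ length (map g (upTo m))
  length≤ = ≤-reflexive (trans (length-oneToN m) (sym (trans (length-map g (upTo m)) (length-upTo m))))
  from-image : ∀ {y} → y ∈ map g (upTo m) → ∃[ i ] i < m × g i ≡ y
  from-image y∈image with i , i∈ , refl ← ∈-map⁻ g y∈image = i , ∈-upTo⁻ i∈ , refl

module _ {m : ℕ} (f : ℕ → ℕ) (closed : ∀ {x} → InRange m x → InRange m (f x))
  (injective : ∀ {x y} → InRange m x → InRange m y → f x ≡ f y → x ≡ y) where

  open IterateOn (InRange m) f closed injective

  private
    orbit-injective : ∀ {x} → InRange m x → (∀ j → 0 < j → j < m → f ^[ j ] x ≢ x) →
      ∀ {i i′} → i < m → i′ < m → f ^[ i ] x ≡ f ^[ i′ ] x → i ≡ i′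
    orbit-injective x∈ no-return {i} {i′} i<m i′<m e with <-cmp i i′
    ... | tri≈ _ i≡i′ _ = i≡i′
    ... | tri< i<i′ _ _ = ⊥-elim (no-return (i′ ∸ i) (m<n⇒0<n∸m i<i′) (≤-<-trans (m∸n≤m i′ i) i′<m)
                                   (^[]-return x∈ (<⇒≤ i<i′) e))
    ... | tri> _ _ i′<i = ⊥-elim (no-return (i ∸ i′) (m<n⇒0<n∸m i′<i) (≤-<-trans (m∸n≤m i i′) i<m)
                                   (^[]-return x∈ (<⇒≤ i′<i) (sym e)))

  exactPeriod-everywhere : ∀ {x} → InRange m x → HasExactPeriod f m x →
    ∀ {y} → InRange m y → HasExactPeriod f m y
  exactPeriod-everywhere {x} x∈ (no-return , returns) y∈
    with j , j<m , refl ← injection-covers (λ i → f ^[ i ] x) (orbit-injective x∈ no-return)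
                            (λ {i} _ → ^[]-closed i x∈) y∈ =
    (λ i 0<i i<m fⁱy≡y → no-return i 0<i i<m (^[]-injective j (^[]-closed i x∈) x∈
       (trans (^[]-swap f j i x) fⁱy≡y))) ,
    trans (^[]-swap f m j x) (cong (f ^[ j ]_) returns)

sumTo : ℕ → (ℕ → ℕ) → ℕ
sumTo m h = sum (map h (oneToN m))

sumTo-suc : ∀ m h → sumTo (suc m) h ≡ sumTo m h + h (suc m)
sumTo-suc m h = begin
  sum (map h (oneToN (suc m)))                ≡⟨ cong (sum ∘ map h) (oneToN-suc m) ⟩
  sum (map h (oneToN m ++ suc m ∷ []))        ≡⟨ cong sum (map-++ h (oneToN m) (suc m ∷ [])) ⟩
  sum (map h (oneToN m) ++ h (suc m) ∷ [])    ≡⟨ sum-++ (map h (oneToN m)) (h (suc m) ∷ []) ⟩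
  sumTo m h + (h (suc m) + 0)                 ≡⟨ cong (sumTo m h +_) (+-identityʳ (h (suc m))) ⟩
  sumTo m h + h (suc m)                       ∎
  where open ≡-Reasoning

sumTo-cong : ∀ m {h h′ : ℕ → ℕ} → (∀ {p} → InRange m p → h p ≡ h′ p) → sumTo m h ≡ sumTo m h′
sumTo-cong m h≡h′ = cong sum (map-cong-local (All.tabulate (h≡h′ ∘ ∈-oneToN⁻)))

sumTo-+ : ∀ m (f g : ℕ → ℕ) → sumTo m (λ p → f p + g p) ≡ sumTo m f + sumTo m g
sumTo-+ m f g = go (oneToN m)
  where
  go : ∀ xs → sum (map (λ p → f p + g p) xs) ≡ sum (map f xs) + sum (map g xs)
  go [] = refl
  go (x ∷ xs) = trans (cong (f x + g x +_) (go xs)) (interchange (f x) (g x) _ _)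

sumTo-cyclicSuc^[] : ∀ m b (h : ℕ → ℕ) → sumTo m (h ∘ (cyclicSuc m ^[ b ]_)) ≡ sumTo m h
sumTo-cyclicSuc^[] m b h = trans (cong sum (map-∘ (oneToN m))) (sum-↭ (map⁺ h (map-cyclicSuc^[]-↭ m b)))

sumTo≡sumBelow : ∀ m (h : ℕ → ℕ) → sumTo m h ≡ sumBelow m (h ∘ suc)
sumTo≡sumBelow m h = trans (cong (sum ∘ map h) (map-upTo suc m)) (sum-applyUpTo h suc m)

module _ {m b : ℕ} (c : ℕ → ℕ) (invariant : ∀ {p} → InRange m p → c (cyclicSuc m ^[ b ] p) ≡ c p) where

  private
    f : ℕ → ℕ
    f = cyclicSuc m
    open CyclicSuc m using (^[]-closed)

    f^[*m] : ∀ y {p} → InRange m p → f ^[ y * m ] p ≡ p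
    f^[*m] y p∈ = ^[*]-fixed f (cyclicSuc^[m] p∈) y

    invariant-* : ∀ x {p} → InRange m p → c (f ^[ x * b ] p) ≡ c p
    invariant-* zero _ = refl
    invariant-* (suc x) {p} p∈ =
      trans (cong c (^[+] f b (x * b) p)) (trans (invariant (^[]-closed (x * b) p∈)) (invariant-* x p∈))

    -- Bézout writes gcd b m as a combination of b and m, and shifting by m is the identity.
    invariant-gcd : ∀ {p} → InRange m p → c (f ^[ gcd b m ] p) ≡ c p
    invariant-gcd {p} p∈ with Bézout.identity (gcd-GCD b m)
    ... | Bézout.+- x y d+ym≡xb = begin
      c (f ^[ gcd b m ] p)                 ≡⟨ cong (λ z → c (f ^[ gcd b m ] z)) (f^[*m] y p∈) ⟨
      c (f ^[ gcd b m ] (f ^[ y * m ] p))  ≡⟨ cong c (^[+] f (gcd b m) (y * m) p) ⟨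
      c (f ^[ gcd b m + y * m ] p)         ≡⟨ cong (λ k → c (f ^[ k ] p)) d+ym≡xb ⟩
      c (f ^[ x * b ] p)                   ≡⟨ invariant-* x p∈ ⟩
      c p                                  ∎
      where open ≡-Reasoning
    ... | Bézout.-+ x y d+xb≡ym = begin
      c (f ^[ gcd b m ] p)                 ≡⟨ invariant-* x (^[]-closed (gcd b m) p∈) ⟨
      c (f ^[ x * b ] (f ^[ gcd b m ] p))  ≡⟨ cong c (^[+] f (x * b) (gcd b m) p) ⟨
      c (f ^[ x * b + gcd b m ] p)         ≡⟨ cong (λ k → c (f ^[ k ] p)) (trans (+-comm (x * b) _) d+xb≡ym) ⟩
      c (f ^[ y * m ] p)                   ≡⟨ cong c (f^[*m] y p∈) ⟩
      c p                                  ∎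
      where open ≡-Reasoning

  cyclicSuc-invariant⇒∣sumTo : ∀ {t} → m ≡ t * gcd b m → t ∣ sumTo m c
  cyclicSuc-invariant⇒∣sumTo {t} m≡td = divides (sumBelow d (c ∘ suc)) (begin
    sumTo m c                    ≡⟨ sumTo≡sumBelow m c ⟩
    sumBelow m (c ∘ suc)         ≡⟨ cong (λ k → sumBelow k (c ∘ suc)) m≡td ⟩
    sumBelow (t * d) (c ∘ suc)   ≡⟨ sumBelow-periodic d t (c ∘ suc) period ⟩
    t * sumBelow d (c ∘ suc)     ≡⟨ *-comm t _ ⟩
    sumBelow d (c ∘ suc) * t     ∎)
    where
    open ≡-Reasoning
    d : ℕ
    d = gcd b m
    period : ∀ i → i + d < t * d → c (suc (i + d)) ≡ c (suc i)
    period i i+d<td = trans (cong c (sym (cyclicSuc^[]-+ d 1+i+d≤m)))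
      (invariant-gcd (s≤s z≤n , ≤-trans (s≤s (m≤m+n i d)) 1+i+d≤m))
      where
      1+i+d≤m : suc i + d ≤ m
      1+i+d≤m = subst (suc (i + d) ≤_) (sym m≡td) i+d<td

indicator : Bool → ℕ
indicator b = if b then 1 else 0

module _ (I : ℕ → ℕ → Bool) where

  rowAbove : ℕ → ℕ → ℕ
  rowAbove m p = sum (map (λ q → indicator (I p q)) (map (λ j → p + suc j) (upTo (m ∸ p))))

  upperSum fullSum diagonalSum : ℕ → ℕ
  upperSum m = sumTo m (rowAbove m)
  fullSum m = sumTo m (λ p → sumTo m (λ q → indicator (I p q)))
  diagonalSum m = sumTo m (λ p → indicator (I p p))

  private
    column : ℕ → ℕ → ℕ
    column m q = sumTo m (λ p → indicator (I p q))

    rowAbove-suc : ∀ m p → p ≤ m → rowAbove (suc m) p ≡ rowAbove m p + indicator (I p (suc m))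
    rowAbove-suc m p p≤m = begin
      sum (map g (map (λ j → p + suc j) (upTo (suc m ∸ p))))
        ≡⟨ cong (λ k → sum (map g (map (λ j → p + suc j) (upTo k)))) (+-∸-assoc 1 p≤m) ⟩
      sum (map g (map (λ j → p + suc j) (upTo (suc (m ∸ p)))))
        ≡⟨ cong (λ l → sum (map g (map (λ j → p + suc j) l))) (upTo-∷ʳ (m ∸ p)) ⟨
      sum (map g (map (λ j → p + suc j) (upTo (m ∸ p) ++ (m ∸ p) ∷ [])))
        ≡⟨ cong (sum ∘ map g) (map-++ (λ j → p + suc j) (upTo (m ∸ p)) ((m ∸ p) ∷ [])) ⟩
      sum (map g (map (λ j → p + suc j) (upTo (m ∸ p)) ++ p + suc (m ∸ p) ∷ []))
        ≡⟨ cong sum (map-++ g (map (λ j → p + suc j) (upTo (m ∸ p))) _) ⟩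
      sum (map g (map (λ j → p + suc j) (upTo (m ∸ p))) ++ g (p + suc (m ∸ p)) ∷ [])
        ≡⟨ sum-++ (map g (map (λ j → p + suc j) (upTo (m ∸ p)))) _ ⟩
      rowAbove m p + (g (p + suc (m ∸ p)) + 0)
        ≡⟨ cong (rowAbove m p +_) (trans (+-identityʳ _) (cong g p+1+[m∸p]≡1+m)) ⟩
      rowAbove m p + g (suc m)
        ∎
      where
      open ≡-Reasoning
      g : ℕ → ℕ
      g q = indicator (I p q)
      p+1+[m∸p]≡1+m : p + suc (m ∸ p) ≡ suc m
      p+1+[m∸p]≡1+m = trans (+-suc p (m ∸ p)) (cong suc (m+[n∸m]≡n p≤m))

    rowAbove-diagonal : ∀ m → rowAbove m m ≡ 0
    rowAbove-diagonal m rewrite n∸n≡0 m = refl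

    upperSum-suc : ∀ m → upperSum (suc m) ≡ upperSum m + column m (suc m)
    upperSum-suc m = begin
      sumTo (suc m) (rowAbove (suc m))
        ≡⟨ sumTo-suc m (rowAbove (suc m)) ⟩
      sumTo m (rowAbove (suc m)) + rowAbove (suc m) (suc m)
        ≡⟨ cong₂ _+_ (sumTo-cong m (λ p∈ → rowAbove-suc m _ (proj₂ p∈))) (rowAbove-diagonal (suc m)) ⟩
      sumTo m (λ p → rowAbove m p + indicator (I p (suc m))) + 0
        ≡⟨ +-identityʳ _ ⟩
      sumTo m (λ p → rowAbove m p + indicator (I p (suc m)))
        ≡⟨ sumTo-+ m (rowAbove m) (λ p → indicator (I p (suc m))) ⟩
      upperSum m + column m (suc m)
        ∎
      where open ≡-Reasoning

    fullSum-suc : ∀ m → fullSum (suc m) ≡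
      fullSum m + column m (suc m) + (sumTo m (λ q → indicator (I (suc m) q)) + indicator (I (suc m) (suc m)))
    fullSum-suc m = begin
      sumTo (suc m) (λ p → sumTo (suc m) (λ q → indicator (I p q)))
        ≡⟨ sumTo-suc m _ ⟩
      sumTo m (λ p → sumTo (suc m) (λ q → indicator (I p q))) + sumTo (suc m) (λ q → indicator (I (suc m) q))
        ≡⟨ cong₂ _+_ (trans (sumTo-cong m (λ {p} _ → sumTo-suc m (λ q → indicator (I p q)))) (sumTo-+ m _ _))
                     (sumTo-suc m _) ⟩
      fullSum m + column m (suc m) + (sumTo m (λ q → indicator (I (suc m) q)) + indicator (I (suc m) (suc m)))
        ∎
      where open ≡-Reasoning

  fullSum≡2*upperSum+diagonalSum : (∀ p q → I p q ≡ I q p) → ∀ m → fullSum m ≡ 2 * upperSum m + diagonalSum m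
  fullSum≡2*upperSum+diagonalSum I-sym zero = refl
  fullSum≡2*upperSum+diagonalSum I-sym (suc m)
    rewrite fullSum-suc m | upperSum-suc m | sumTo-suc m (λ p → indicator (I p p))
          | fullSum≡2*upperSum+diagonalSum I-sym m
          | sumTo-cong m {λ q → indicator (I (suc m) q)} (λ {p} _ → cong indicator (I-sym (suc m) p)) =
    solve 4 (λ u d a x → ((con 2 :* u :+ d) :+ a) :+ (a :+ x) := con 2 :* (u :+ a) :+ (d :+ x)) refl
      (upperSum m) (diagonalSum m) (column m (suc m)) (indicator (I (suc m) (suc m)))
    where open +-*-Solver

lastOr : ℕ → List ℕ → ℕ
lastOr p [] = p
lastOr p (x ∷ xs) = lastOr x xs

fromMaybe-last≡lastOr : ∀ p xs → fromMaybe p (last xs) ≡ lastOr p xs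
fromMaybe-last≡lastOr p [] = refl
fromMaybe-last≡lastOr p (x ∷ []) = refl
fromMaybe-last≡lastOr p (x ∷ y ∷ xs) = fromMaybe-last≡lastOr p (y ∷ xs)

lastOr-++-∷ : ∀ p y xs ys → lastOr p (xs ++ y ∷ ys) ≡ lastOr y ys
lastOr-++-∷ p y [] ys = refl
lastOr-++-∷ p y (x ∷ xs) ys = lastOr-++-∷ x y xs ys

lastOr-∈ : ∀ p s → lastOr p s ∈ p ∷ s
lastOr-∈ p [] = here refl
lastOr-∈ p (x ∷ s) = there (lastOr-∈ x s)

predIn-head : ∀ p a s → predIn p (a ∷ s) a ≡ p
predIn-head p a s rewrite ≡ᵇ-refl a = refl

predIn-≢ : ∀ {p x a} s → x ≢ a → predIn p (x ∷ s) a ≡ predIn x s a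
predIn-≢ s x≢a rewrite ≢⇒≡ᵇ-false x≢a = refl

predIn-++ˡ : ∀ p {a} xs ys → a ∈ xs → predIn p (xs ++ ys) a ≡ predIn p xs a
predIn-++ˡ p {a} (x ∷ xs) ys a∈ with x ≟ a
... | yes refl = trans (predIn-head p x (xs ++ ys)) (sym (predIn-head p x xs))
... | no x≢a with a∈
...   | here refl = ⊥-elim (x≢a refl)
...   | there a∈xs = trans (predIn-≢ (xs ++ ys) x≢a) (trans (predIn-++ˡ x xs ys a∈xs) (sym (predIn-≢ xs x≢a)))

predIn-++ʳ : ∀ p {a} xs ys → a ∉ xs → predIn p (xs ++ ys) a ≡ predIn (lastOr p xs) ys a
predIn-++ʳ p [] ys _ = refl
predIn-++ʳ p (x ∷ xs) ys a∉ =
  trans (predIn-≢ (xs ++ ys) (λ { refl → a∉ (here refl) })) (predIn-++ʳ x xs ys (a∉ ∘ there))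

predecessors : ℕ → List ℕ → List ℕ
predecessors p [] = []
predecessors p (x ∷ xs) = p ∷ predecessors x xs

predecessors-∷ʳ : ∀ p y xs → predecessors p (xs ++ y ∷ []) ≡ p ∷ xs
predecessors-∷ʳ p y [] = refl
predecessors-∷ʳ p y (x ∷ xs) = cong (p ∷_) (predecessors-∷ʳ x y xs)

predecessors⊆ : ∀ p s {y} → y ∈ predecessors p s → y ∈ p ∷ s
predecessors⊆ p (x ∷ s) (here refl) = here refl
predecessors⊆ p (x ∷ s) (there y∈) = there (predecessors⊆ x s y∈)

predIn-∈-predecessors : ∀ p {a} s → a ∈ s → predIn p s a ∈ predecessors p s
predIn-∈-predecessors p {a} (x ∷ s) a∈ with x ≟ a
... | yes refl rewrite predIn-head p x s = here refl
... | no x≢a with a∈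
...   | here refl = ⊥-elim (x≢a refl)
...   | there a∈s rewrite predIn-≢ {p} s x≢a = there (predIn-∈-predecessors x s a∈s)

predIn-∈ : ∀ p a s → predIn p s a ∈ p ∷ s ⊎ predIn p s a ≡ a
predIn-∈ p a [] = inj₂ refl
predIn-∈ p a (x ∷ s) with x ≟ a
... | yes refl rewrite predIn-head p x s = inj₁ (here refl)
... | no x≢a rewrite predIn-≢ {p} s x≢a with predIn-∈ x a s
...   | inj₁ y∈ = inj₁ (there y∈)
...   | inj₂ e = inj₂ e

∈-∷-≢ : ∀ {x y : ℕ} {s} → y ∈ x ∷ s → x ≢ y → y ∈ s
∈-∷-≢ (here refl) x≢y = ⊥-elim (x≢y refl)
∈-∷-≢ (there y∈) _ = y∈

predIn-injective : ∀ p s → Unique (predecessors p s) → ∀ {a b} → a ∈ s → b ∈ s →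
  predIn p s a ≡ predIn p s b → a ≡ b
predIn-injective p (x ∷ s) (p∉ ∷ preds!) {a} {b} a∈ b∈ e with x ≟ a | x ≟ b
... | yes refl | yes refl = refl
... | yes refl | no x≢b = ⊥-elim (All.lookup p∉ (predIn-∈-predecessors x s (∈-∷-≢ b∈ x≢b))
                            (trans (sym (predIn-head p x s)) (trans e (predIn-≢ s x≢b))))
... | no x≢a | yes refl = ⊥-elim (All.lookup p∉ (predIn-∈-predecessors x s (∈-∷-≢ a∈ x≢a))
                            (trans (sym (predIn-head p x s)) (trans (sym e) (predIn-≢ s x≢a))))
... | no x≢a | no x≢b = predIn-injective x s preds! (∈-∷-≢ a∈ x≢a) (∈-∷-≢ b∈ x≢b)
                          (trans (sym (predIn-≢ s x≢a)) (trans e (predIn-≢ s x≢b)))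

predIn≡⇒adjacent : ∀ {p a v} s → Unique s → predIn p s a ≡ v → v ≢ p → v ≢ a →
  ∃[ A ] ∃[ B ] s ≡ A ++ v ∷ a ∷ B
predIn≡⇒adjacent [] _ e _ v≢a = ⊥-elim (v≢a (sym e))
predIn≡⇒adjacent {p} {a} {v} (x ∷ s) (x∉ ∷ s!) e v≢p v≢a with x ≟ a
... | yes refl rewrite predIn-head p x s = ⊥-elim (v≢p (sym e))
... | no x≢a rewrite predIn-≢ {p} s x≢a with v ≟ x
...   | no v≢x with A , B , refl ← predIn≡⇒adjacent s s! e v≢x v≢a = x ∷ A , B , refl
...   | yes refl = after-v s x∉ e
  where
  after-v : ∀ s → All (v ≢_) s → predIn v s a ≡ v → ∃[ A ] ∃[ B ] v ∷ s ≡ A ++ v ∷ a ∷ B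
  after-v [] _ e′ = ⊥-elim (v≢a (sym e′))
  after-v (y ∷ ys) (v≢y ∷ v∉) e′ with y ≟ a
  ... | yes refl = [] , ys , refl
  ... | no y≢a rewrite predIn-≢ {v} ys y≢a with predIn-∈ y a ys
  ...   | inj₂ e₂ = ⊥-elim (v≢a (trans (sym e′) e₂))
  ...   | inj₁ (here e₂) = ⊥-elim (v≢y (trans (sym e′) e₂))
  ...   | inj₁ (there e₂) = ⊥-elim (All.lookup v∉ e₂ (sym e′))

predIn-map : ∀ (g : ℕ → ℕ) p a s → (∀ {x} → x ∈ s → g x ≡ g a → x ≡ a) →
  predIn (g p) (map g s) (g a) ≡ g (predIn p s a)
predIn-map g p a [] _ = refl
predIn-map g p a (x ∷ s) g-inj with x ≟ a
... | yes refl rewrite predIn-head (g p) (g x) (map g s) | predIn-head p x s = refl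
... | no x≢a rewrite predIn-≢ {g p} (map g s) (x≢a ∘ g-inj (here refl)) | predIn-≢ {p} s x≢a =
  predIn-map g x a s (g-inj ∘ there)

cyclicPredecessors! : ∀ p s → Unique s → Unique (predecessors (lastOr p s) s)
cyclicPredecessors! p s s! with initLast s
... | [] = []
... | xs ∷ʳ′ y rewrite lastOr-++-∷ p y xs [] | predecessors-∷ʳ y y xs =
  Unique-resp-↭ (↭⇒↭ₛ (↭-sym (∷↭∷ʳ y xs))) s!

cyclicPred : List ℕ → ℕ → ℕ
cyclicPred σ = predIn (lastOr 0 σ) σ

cyclicPred-rotate : ∀ σ → Unique σ → ∀ {a} → a ∈ σ → cyclicPred (rotate σ) a ≡ cyclicPred σ a
cyclicPred-rotate (y ∷ ys) (y∉ ∷ _) {a} a∈ rewrite lastOr-++-∷ 0 y ys [] with y ≟ a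
... | yes refl = begin
  predIn y (ys ++ y ∷ []) y             ≡⟨ predIn-++ʳ y ys (y ∷ []) (λ y∈ → All.lookup y∉ y∈ refl) ⟩
  predIn (lastOr y ys) (y ∷ []) y       ≡⟨ predIn-head (lastOr y ys) y [] ⟩
  lastOr y ys                           ≡⟨ predIn-head (lastOr y ys) y ys ⟨
  predIn (lastOr y ys) (y ∷ ys) y       ∎
  where open ≡-Reasoning
... | no y≢a = trans (predIn-++ˡ y ys (y ∷ []) (∈-∷-≢ a∈ y≢a)) (sym (predIn-≢ ys y≢a))

lastOr-map : ∀ (g : ℕ → ℕ) p s → lastOr (g p) (map g s) ≡ g (lastOr p s)
lastOr-map g p [] = refl
lastOr-map g p (x ∷ s) = lastOr-map g x s

cyclicPred-map : ∀ (g : ℕ → ℕ) σ a → (∀ {x} → x ∈ σ → g x ≡ g a → x ≡ a) →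
  cyclicPred (map g σ) (g a) ≡ g (cyclicPred σ a)
cyclicPred-map g [] a _ = refl
cyclicPred-map g (y ∷ ys) a g-inj = trans (cong (λ p → predIn p (map g (y ∷ ys)) (g a)) (lastOr-map g y ys))
  (predIn-map g (lastOr y ys) a (y ∷ ys) g-inj)

-- Strategic piles

Avoids : (ℕ → ℕ) → ℕ → ℕ → ℕ → Set
Avoids C N x j = ∀ i → i < j → C ^[ i ] x ≢ 0 × C ^[ i ] x ≢ N

private
  Avoids-step : ∀ {C N x j} → x ≢ 0 → x ≢ N → Avoids C N (C x) j → Avoids C N x (suc j)
  Avoids-step x≢0 x≢N _ zero _ = x≢0 , x≢N
  Avoids-step {C} {N} {x} _ _ avoids (suc i) (s≤s i<j) =
    subst (λ y → y ≢ 0 × y ≢ N) (sym (^[]-comm C i x)) (avoids i i<j)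

  Avoids-tail : ∀ {C N x j} → Avoids C N x (suc j) → Avoids C N (C x) j
  Avoids-tail {C} {N} {x} avoids i i<j =
    subst (λ y → y ≢ 0 × y ≢ N) (^[]-comm C i x) (avoids (suc i) (s≤s i<j))

walk≡just⇒ : ∀ fuel C N x l → walk fuel C N x ≡ just l → Avoids C N x (length l) × C ^[ length l ] x ≡ 0
walk≡just⇒ (suc fuel) C N x l e with x ≟ 0
walk≡just⇒ (suc fuel) C N x l refl | yes refl = (λ _ ()) , refl
... | no x≢0 rewrite ≢⇒≡ᵇ-false x≢0 with x ≟ N
...   | yes refl rewrite ≡ᵇ-refl x with () ← e
...   | no x≢N rewrite ≢⇒≡ᵇ-false x≢N with walk fuel C N (C x) in walk≡
...     | just l′ with refl ← e with avoids , reaches ← walk≡just⇒ fuel C N (C x) l′ walk≡ =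
  Avoids-step x≢0 x≢N avoids , trans (^[]-comm C (length l′) x) reaches

walk≡just⇐ : ∀ fuel C N x j → j < fuel → Avoids C N x j → C ^[ j ] x ≡ 0 →
  ∃[ l ] walk fuel C N x ≡ just l × length l ≡ j
walk≡just⇐ (suc fuel) C N x zero _ _ reaches rewrite reaches = [] , refl , refl
walk≡just⇐ (suc fuel) C N x (suc j) (s≤s j<fuel) avoids reaches
  rewrite ≢⇒≡ᵇ-false (proj₁ (avoids 0 (s≤s z≤n))) | ≢⇒≡ᵇ-false (proj₂ (avoids 0 (s≤s z≤n)))
  with l , walk≡ , refl ← walk≡just⇐ fuel C N (C x) j j<fuel (Avoids-tail avoids)
                            (trans (sym (^[]-comm C j x)) reaches)
  rewrite walk≡ = x ∷ l , refl , refl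

PileOfLength : ℕ → List ℕ → Set
PileOfLength m π = Avoids C N (C N) m × C ^[ m ] (C N) ≡ 0
  where
  C : ℕ → ℕ
  C = Ccyc π
  N : ℕ
  N = length π

strategicPile-length⇒PileOfLength : ∀ {m} π → 1 ≤ m → length (strategicPile π) ≡ m → PileOfLength m π
strategicPile-length⇒PileOfLength {m} π 1≤m e
  with walk (suc (length π)) (Ccyc π) (length π) (Ccyc π (length π)) in walk≡
... | nothing = ⊥-elim (<-irrefl e 1≤m)
... | just l rewrite sym e = walk≡just⇒ (suc (length π)) (Ccyc π) (length π) (Ccyc π (length π)) l walk≡

PileOfLength⇒strategicPile-length : ∀ {m} π → m ≤ length π → PileOfLength m π → length (strategicPile π) ≡ m
PileOfLength⇒strategicPile-length {m} π m≤N (avoids , reaches)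
  with l , walk≡ , refl ← walk≡just⇐ (suc (length π)) (Ccyc π) (length π) (Ccyc π (length π)) m (s≤s m≤N) avoids reaches
  rewrite walk≡ = refl

-- The inverse of the contraction: insert m + 1 = 2n immediately before 1.
expand : ℕ → List ℕ → List ℕ
expand m [] = []
expand m (x ∷ xs) = if x ≡ᵇ 1 then suc m ∷ 1 ∷ expand m xs else x ∷ expand m xs

private
  expand-no1 : ∀ m A → All (_≢ 1) A → expand m A ≡ A
  expand-no1 m [] [] = refl
  expand-no1 m (x ∷ A) (x≢1 ∷ A≢1) rewrite ≢⇒≡ᵇ-false x≢1 = cong (x ∷_) (expand-no1 m A A≢1)

  expand-++ : ∀ m A B → expand m (A ++ B) ≡ expand m A ++ expand m B
  expand-++ m [] B = refl
  expand-++ m (x ∷ A) B with x ≡ᵇ 1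
  ... | true = cong (λ z → suc m ∷ 1 ∷ z) (expand-++ m A B)
  ... | false = cong (x ∷_) (expand-++ m A B)

expand-split : ∀ m A B → Unique (A ++ 1 ∷ B) → expand m (A ++ 1 ∷ B) ≡ A ++ suc m ∷ 1 ∷ B
expand-split m A B AB! with A≢1 , B≢1 ← Unique-middle {xs = A} AB! = trans (expand-++ m A (1 ∷ B))
  (cong₂ _++_ (expand-no1 m A A≢1) (cong (λ z → suc m ∷ 1 ∷ z) (expand-no1 m B B≢1)))

IsPerm-split : ∀ {m σ} → IsPerm m σ → 1 ≤ m → ∃[ A ] ∃[ B ] σ ≡ A ++ 1 ∷ B
IsPerm-split σ-perm 1≤m = ∈-∃++ (complete σ-perm (≤-refl , 1≤m))

expand-length : ∀ {m σ} → IsPerm m σ → 1 ≤ m → length (expand m σ) ≡ suc m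
expand-length {m} {σ} σ-perm 1≤m with A , B , refl ← IsPerm-split σ-perm 1≤m
  rewrite expand-split m A B (unique σ-perm) = trans (length-++-∷ A (1 ∷ B)) (cong suc (length≡ σ-perm))

-- C_σ on {1, …, m}: X_m followed by Y_σ, where Y_σ reads σ cyclically (the 0 of Y_π is omitted).
reducedC : ℕ → List ℕ → ℕ → ℕ
reducedC m σ x = cyclicPred σ (cyclicSuc m x)

IsMCycle : ℕ → List ℕ → Set
IsMCycle m σ = ∀ {y} → InRange m y → HasExactPeriod (reducedC m σ) m y

lastOr-inRange : ∀ {m σ} → IsPerm m σ → 1 ≤ m → InRange m (lastOr 0 σ)
lastOr-inRange {σ = []} σ-perm 1≤m with () ← complete σ-perm (≤-refl , 1≤m)
lastOr-inRange {σ = x ∷ σ} σ-perm _ = bounded σ-perm (lastOr-∈ x σ)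

reducedC-inRange : ∀ {m σ} → IsPerm m σ → 1 ≤ m → ∀ {x} → InRange m x → InRange m (reducedC m σ x)
reducedC-inRange {m} {σ} σ-perm 1≤m {x} x∈
  with predecessors⊆ (lastOr 0 σ) σ (predIn-∈-predecessors (lastOr 0 σ) σ (complete σ-perm (cyclicSuc-inRange x∈)))
... | here e = subst (InRange m) (sym e) (lastOr-inRange σ-perm 1≤m)
... | there y∈σ = bounded σ-perm y∈σ

reducedC-injective : ∀ {m σ} → IsPerm m σ → ∀ {x y} → InRange m x → InRange m y →
  reducedC m σ x ≡ reducedC m σ y → x ≡ y
reducedC-injective {m} {σ} σ-perm x∈ y∈ e = cyclicSuc-injective x∈ y∈
  (predIn-injective (lastOr 0 σ) σ (cyclicPredecessors! 0 σ (unique σ-perm))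
    (complete σ-perm (cyclicSuc-inRange x∈)) (complete σ-perm (cyclicSuc-inRange y∈)) e)

private
  raise : ℕ → ℕ → ℕ
  raise m a = if a ≡ᵇ 1 then suc m else a

  headOr1 : List ℕ → ℕ
  headOr1 [] = 1
  headOr1 (x ∷ _) = x

  predIn-headOr1 : ∀ p A B → predIn p (A ++ 1 ∷ B) (headOr1 A) ≡ p
  predIn-headOr1 p [] B = predIn-head p 1 B
  predIn-headOr1 p (x ∷ A) B = predIn-head p x (A ++ 1 ∷ B)

  headOr1-∈ : ∀ A B → headOr1 A ∈ A ++ 1 ∷ B
  headOr1-∈ [] B = here refl
  headOr1-∈ (x ∷ A) B = here refl

  predIn-raise-head : ∀ m p A B → All (_≢ 1) A → predIn p (A ++ suc m ∷ 1 ∷ B) (raise m (headOr1 A)) ≡ p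
  predIn-raise-head m p [] B _ = predIn-head p (suc m) (1 ∷ B)
  predIn-raise-head m p (x ∷ A) B (x≢1 ∷ _) rewrite ≢⇒≡ᵇ-false x≢1 = predIn-head p x (A ++ suc m ∷ 1 ∷ B)

  predIn-raise : ∀ m A B → All (λ x → x ≢ 1 × x ≢ suc m) A → ∀ a → a ≢ suc m → a ≢ headOr1 A →
    ∀ p q → predIn p (A ++ suc m ∷ 1 ∷ B) (raise m a) ≡ predIn q (A ++ 1 ∷ B) a
  predIn-raise m [] B _ a a≢N a≢1 p q
    rewrite ≢⇒≡ᵇ-false a≢1 | ≢⇒≡ᵇ-false (a≢N ∘ sym) | ≢⇒≡ᵇ-false (a≢1 ∘ sym) = refl
  predIn-raise m (x ∷ A) B ((x≢1 , x≢N) ∷ A-avoids) a a≢N a≢x p q = begin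
    predIn p (x ∷ A ++ suc m ∷ 1 ∷ B) (raise m a) ≡⟨ predIn-≢ (A ++ suc m ∷ 1 ∷ B) x≢raise ⟩
    predIn x (A ++ suc m ∷ 1 ∷ B) (raise m a)     ≡⟨ rest ⟩
    predIn x (A ++ 1 ∷ B) a                       ≡⟨ predIn-≢ (A ++ 1 ∷ B) (a≢x ∘ sym) ⟨
    predIn q (x ∷ A ++ 1 ∷ B) a                   ∎
    where
    open ≡-Reasoning
    x≢raise : x ≢ raise m a
    x≢raise e with a ≟ 1
    ... | yes refl = x≢N e
    ... | no a≢1 rewrite ≢⇒≡ᵇ-false a≢1 = a≢x (sym e)
    rest : predIn x (A ++ suc m ∷ 1 ∷ B) (raise m a) ≡ predIn x (A ++ 1 ∷ B) a
    rest with a ≟ headOr1 A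
    ... | no a≢hd = predIn-raise m A B A-avoids a a≢N a≢hd x x
    ... | yes refl = trans (predIn-raise-head m x A B (All.map proj₁ A-avoids)) (sym (predIn-headOr1 x A B))

module Expansion {m : ℕ} (A B : List ℕ) (σ-perm : IsPerm m (A ++ 1 ∷ B)) (1≤m : 1 ≤ m) where

  σ π : List ℕ
  σ = A ++ 1 ∷ B
  π = A ++ suc m ∷ 1 ∷ B

  ℓ : ℕ
  ℓ = lastOr 0 σ

  f C : ℕ → ℕ
  f = reducedC m σ
  C = Ccyc π

  length-π : length π ≡ suc m
  length-π = trans (length-++-∷ A (1 ∷ B)) (cong suc (length≡ σ-perm))

  private
    ℓ∈ : InRange m ℓ
    ℓ∈ = lastOr-inRange σ-perm 1≤m

    A-avoids : All (λ x → x ≢ 1 × x ≢ suc m) A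
    A-avoids = All.tabulate λ x∈ → All.lookup (proj₁ (Unique-middle {xs = A} (unique σ-perm))) x∈ ,
             λ e → <-irrefl e (s≤s (proj₂ (bounded σ-perm (∈-++⁺ˡ x∈))))

    last-π : fromMaybe 0 (last π) ≡ ℓ
    last-π = trans (fromMaybe-last≡lastOr 0 π) (trans (lastOr-++-∷ 0 (suc m) A (1 ∷ B)) (sym (lastOr-++-∷ 0 1 A B)))

    preds! : Unique (predecessors ℓ σ)
    preds! = cyclicPredecessors! 0 σ (unique σ-perm)

    succ∈σ : ∀ {x} → InRange m x → cyclicSuc m x ∈ σ
    succ∈σ = complete σ-perm ∘ cyclicSuc-inRange

    predIn-ℓ-headOr1 : predIn ℓ σ (headOr1 A) ≡ ℓ
    predIn-ℓ-headOr1 = predIn-headOr1 ℓ A B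

    X≡raise : ∀ {x} → InRange m x → Xcyc (length π) x ≡ raise m (cyclicSuc m x)
    X≡raise {x} (1≤x , x≤m) rewrite length-π | <⇒<ᵇ-true (s≤s x≤m) with x ≟ m
    ... | yes refl rewrite cyclicSuc-top {m} = refl
    ... | no x≢m rewrite cyclicSuc-≢ x≢m | ≢⇒≡ᵇ-false {suc x} {1} (λ e → <-irrefl (sym (suc-injective e)) 1≤x) = refl

    raise-≢0 : ∀ {a} → InRange m a → 0 ≢ raise m a
    raise-≢0 {a} (1≤a , _) e with a ≟ 1
    ... | yes refl with () ← e
    ... | no a≢1 rewrite ≢⇒≡ᵇ-false a≢1 = <-irrefl e 1≤a

    C-via-π : ∀ {x} → InRange m x → C x ≡ predIn 0 π (raise m (cyclicSuc m x))
    C-via-π x∈ = trans (cong (Ycyc π) (X≡raise x∈)) (predIn-≢ π (raise-≢0 (cyclicSuc-inRange x∈)))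

  C-top : C (suc m) ≡ ℓ
  C-top = begin
    Ycyc π (Xcyc (length π) (suc m)) ≡⟨ cong (λ k → Ycyc π (Xcyc k (suc m))) length-π ⟩
    Ycyc π (Xcyc (suc m) (suc m))    ≡⟨ cong (λ b → Ycyc π (if b then suc (suc m) else 0)) (<ᵇ-irrefl (suc m)) ⟩
    predIn (fromMaybe 0 (last π)) (0 ∷ π) 0 ≡⟨ predIn-head _ 0 π ⟩
    fromMaybe 0 (last π)             ≡⟨ last-π ⟩
    ℓ                                ∎
    where open ≡-Reasoning

  -- C agrees with f on {1, …, m} except at the preimage of ℓ, which C sends to 0; so the walk of
  -- C from N = m + 1 is N, ℓ, f ℓ, f² ℓ, … until f returns to ℓ.
  C≡f : ∀ {x} → InRange m x → f x ≢ ℓ → C x ≡ f x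
  C≡f {x} x∈ fx≢ℓ = trans (C-via-π x∈) (predIn-raise m A B A-avoids (cyclicSuc m x)
    (λ e → <-irrefl e (s≤s (proj₂ (cyclicSuc-inRange x∈))))
    (λ e → fx≢ℓ (trans (cong (predIn ℓ σ) e) predIn-ℓ-headOr1)) 0 ℓ)

  C≡0 : ∀ {x} → InRange m x → f x ≡ ℓ → C x ≡ 0
  C≡0 {x} x∈ fx≡ℓ = trans (C-via-π x∈) (trans (cong (λ z → predIn 0 π (raise m z)) succ≡head)
    (predIn-raise-head m 0 A B (All.map proj₁ A-avoids)))
    where
    succ≡head : cyclicSuc m x ≡ headOr1 A
    succ≡head = predIn-injective ℓ σ preds! (succ∈σ x∈) (headOr1-∈ A B) (trans fx≡ℓ (sym predIn-ℓ-headOr1))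

  private
    open IterateOn (InRange m) f (reducedC-inRange σ-perm 1≤m) (reducedC-injective σ-perm)

    orbit-inRange : ∀ i → InRange m (f ^[ i ] ℓ)
    orbit-inRange i = ^[]-closed i ℓ∈

    NoReturn : ℕ → Set
    NoReturn i = ∀ j → j < i → f ^[ suc j ] ℓ ≢ ℓ

    C-follows-f : ∀ i → NoReturn i → C ^[ i ] ℓ ≡ f ^[ i ] ℓ
    C-follows-f zero _ = refl
    C-follows-f (suc i) no-return =
      trans (cong C (C-follows-f i (λ j j<i → no-return j (≤-trans j<i (n≤1+n i)))))
            (C≡f (orbit-inRange i) (no-return i ≤-refl))

    inRange-≢ : ∀ {x} → InRange m x → x ≢ 0 × x ≢ suc m
    inRange-≢ (1≤x , x≤m) = (λ e → <-irrefl (sym e) 1≤x) , (λ e → <-irrefl e (s≤s x≤m))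

    ReachesZero : Set
    ReachesZero = Avoids C (suc m) ℓ m × C ^[ m ] ℓ ≡ 0

    PileOfLength≡ReachesZero : PileOfLength m π ≡ ReachesZero
    PileOfLength≡ReachesZero = trans (cong (λ N → Avoids C N (C N) m × C ^[ m ] (C N) ≡ 0) length-π)
                            (cong (λ z → Avoids C (suc m) z m × C ^[ m ] z ≡ 0) C-top)

    m′ : ℕ
    m′ = m ∸ 1

    1+m′≡m : suc m′ ≡ m
    1+m′≡m = m+[n∸m]≡n 1≤m

    no-return-before : ReachesZero → ∀ i → suc i ≤ m → NoReturn i
    no-return-before reaches-0 zero _ j ()
    no-return-before reaches-0 (suc i) 2+i≤m j j<1+i with m≤n⇒m<n∨m≡n (s≤s⁻¹ j<1+i)
    ... | inj₁ j<i = no-return-before reaches-0 i (≤-trans (n≤1+n (suc i)) 2+i≤m) j j<i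
    ... | inj₂ refl = λ fʲ⁺¹ℓ≡ℓ → proj₁ (proj₁ reaches-0 (suc j) 2+i≤m)
            (trans (cong C (C-follows-f j (no-return-before reaches-0 j (≤-trans (n≤1+n (suc j)) 2+i≤m))))
                   (C≡0 (orbit-inRange j) fʲ⁺¹ℓ≡ℓ))

  PileOfLength⇒exactPeriod : PileOfLength m π → HasExactPeriod f m ℓ
  PileOfLength⇒exactPeriod pile with reaches-0 ← subst (λ T → T) PileOfLength≡ReachesZero pile = no-return , returns
    where
    no-return′ : NoReturn m′
    no-return′ = no-return-before reaches-0 m′ (≤-reflexive 1+m′≡m)
    no-return : ∀ j → 0 < j → j < m → f ^[ j ] ℓ ≢ ℓ
    no-return (suc j) _ 1+j<m = no-return′ j (s≤s⁻¹ (subst (suc (suc j) ≤_) (sym 1+m′≡m) 1+j<m))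
    returns : f ^[ m ] ℓ ≡ ℓ
    returns with f ^[ m ] ℓ ≟ ℓ
    ... | yes fᵐℓ≡ℓ = fᵐℓ≡ℓ
    ... | no fᵐℓ≢ℓ = ⊥-elim (proj₁ (inRange-≢ (orbit-inRange m)) (begin
      f ^[ m ] ℓ          ≡⟨ cong (λ k → f ^[ k ] ℓ) 1+m′≡m ⟨
      f (f ^[ m′ ] ℓ)     ≡⟨ C≡f (orbit-inRange m′) (subst (λ k → f ^[ k ] ℓ ≢ ℓ) (sym 1+m′≡m) fᵐℓ≢ℓ) ⟨
      C (f ^[ m′ ] ℓ)     ≡⟨ cong C (C-follows-f m′ no-return′) ⟨
      C ^[ suc m′ ] ℓ     ≡⟨ cong (λ k → C ^[ k ] ℓ) 1+m′≡m ⟩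
      C ^[ m ] ℓ          ≡⟨ proj₂ reaches-0 ⟩
      0                   ∎))
      where open ≡-Reasoning

  exactPeriod⇒PileOfLength : HasExactPeriod f m ℓ → PileOfLength m π
  exactPeriod⇒PileOfLength (no-return , returns) = subst (λ T → T) (sym PileOfLength≡ReachesZero) (avoids , reaches)
    where
    no-return′ : NoReturn m′
    no-return′ j j<m′ = no-return (suc j) (s≤s z≤n) (subst (suc (suc j) ≤_) 1+m′≡m (s≤s j<m′))
    avoids : Avoids C (suc m) ℓ m
    avoids i i<m = subst (λ z → z ≢ 0 × z ≢ suc m)
      (sym (C-follows-f i (λ j j<i → no-return′ j (<-≤-trans j<i (s≤s⁻¹ (subst (suc i ≤_) (sym 1+m′≡m) i<m))))))
      (inRange-≢ (orbit-inRange i))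
    reaches : C ^[ m ] ℓ ≡ 0
    reaches = begin
      C ^[ m ] ℓ          ≡⟨ cong (λ k → C ^[ k ] ℓ) 1+m′≡m ⟨
      C (C ^[ m′ ] ℓ)     ≡⟨ cong C (C-follows-f m′ no-return′) ⟩
      C (f ^[ m′ ] ℓ)     ≡⟨ C≡0 (orbit-inRange m′) (trans (cong (λ k → f ^[ k ] ℓ) 1+m′≡m) returns) ⟩
      0                   ∎
      where open ≡-Reasoning

module _ {m σ} (σ-perm : IsPerm m σ) (1≤m : 1 ≤ m) where

  private
    f : ℕ → ℕ
    f = reducedC m σ

    f-inRange : ∀ {x} → InRange m x → InRange m (f x)
    f-inRange = reducedC-inRange σ-perm 1≤m

    open IterateOn (InRange m) f f-inRange (reducedC-injective σ-perm) using (^[]-conjugate)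

  maxPile⇒IsMCycle : length (strategicPile (expand m σ)) ≡ m → IsMCycle m σ
  maxPile⇒IsMCycle pile with A , B , refl ← IsPerm-split σ-perm 1≤m
    rewrite expand-split m A B (unique σ-perm) =
    exactPeriod-everywhere f f-inRange (reducedC-injective σ-perm) (lastOr-inRange σ-perm 1≤m)
      (E.PileOfLength⇒exactPeriod (strategicPile-length⇒PileOfLength E.π 1≤m pile))
    where module E = Expansion A B σ-perm 1≤m

  IsMCycle⇒maxPile : IsMCycle m σ → length (strategicPile (expand m σ)) ≡ m
  IsMCycle⇒maxPile cycle with A , B , refl ← IsPerm-split σ-perm 1≤m
    rewrite expand-split m A B (unique σ-perm) =
    PileOfLength⇒strategicPile-length E.π (≤-trans (n≤1+n m) (≤-reflexive (sym E.length-π)))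
      (E.exactPeriod⇒PileOfLength (cycle (lastOr-inRange σ-perm 1≤m)))
    where module E = Expansion A B σ-perm 1≤m

  IsMCycle-rotate : IsMCycle m σ → IsMCycle m (rotate σ)
  IsMCycle-rotate cycle {y} y∈ = no-return , returns
    where
    agree : ∀ i → reducedC m (rotate σ) ^[ i ] y ≡ f ^[ i ] y
    agree i = ^[]-conjugate (reducedC m (rotate σ)) (λ x → x)
      (λ x∈ → cyclicPred-rotate σ (unique σ-perm) (complete σ-perm (cyclicSuc-inRange x∈))) i y∈
    no-return : ∀ j → 0 < j → j < m → reducedC m (rotate σ) ^[ j ] y ≢ y
    no-return j 0<j j<m e = proj₁ (cycle y∈) j 0<j j<m (trans (sym (agree j)) e)
    returns : reducedC m (rotate σ) ^[ m ] y ≡ y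
    returns = trans (agree m) (proj₂ (cycle y∈))

  IsMCycle-cyclicSuc : IsMCycle m σ → IsMCycle m (map (cyclicSuc m) σ)
  IsMCycle-cyclicSuc cycle {y′} y′∈ with y , y∈ , refl ← cyclicSuc-surjective y′∈ = no-return , returns
    where
    g : ℕ → ℕ
    g = reducedC m (map (cyclicSuc m) σ)
    commutes : ∀ {x} → InRange m x → g (cyclicSuc m x) ≡ cyclicSuc m (f x)
    commutes x∈ = cyclicPred-map (cyclicSuc m) σ _
      (λ z∈ → cyclicSuc-injective (bounded σ-perm z∈) (cyclicSuc-inRange x∈))
    conjugate : ∀ i → g ^[ i ] (cyclicSuc m y) ≡ cyclicSuc m (f ^[ i ] y)
    conjugate i = ^[]-conjugate g (cyclicSuc m) commutes i y∈
    no-return : ∀ j → 0 < j → j < m → g ^[ j ] (cyclicSuc m y) ≢ cyclicSuc m y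
    no-return j 0<j j<m e = proj₁ (cycle y∈) j 0<j j<m
      (cyclicSuc-injective (IterateOn.^[]-closed (InRange m) f f-inRange (reducedC-injective σ-perm) j y∈) y∈
        (trans (sym (conjugate j)) e))
    returns : g ^[ m ] (cyclicSuc m y) ≡ cyclicSuc m y
    returns = trans (conjugate m) (cong (cyclicSuc m) (proj₂ (cycle y∈)))

module _ {m π} (π-perm : IsPerm (suc m) π) (1≤m : 1 ≤ m) (pile : length (strategicPile π) ≡ m) where

  private
    N : ℕ
    N = suc m

    C : ℕ → ℕ
    C = Ccyc π

    ℓ : ℕ
    ℓ = fromMaybe 0 (last π)

    reaches-0 : Avoids C N (C N) m × C ^[ m ] (C N) ≡ 0
    reaches-0 = subst (λ L → Avoids C L (C L) m × C ^[ m ] (C L) ≡ 0) (length≡ π-perm)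
              (strategicPile-length⇒PileOfLength π 1≤m pile)

    0π! : Unique (0 ∷ π)
    0π! = All.tabulate (λ x∈ e → <-irrefl e (proj₁ (bounded π-perm x∈))) ∷ unique π-perm

    preds! : Unique (predecessors ℓ (0 ∷ π))
    preds! = subst (λ p → Unique (predecessors p (0 ∷ π))) (sym (fromMaybe-last≡lastOr 0 π))
               (cyclicPredecessors! 0 (0 ∷ π) 0π!)

    X-top : Xcyc N N ≡ 0
    X-top = cong (λ b → if b then suc N else 0) (<ᵇ-irrefl N)

    X-< : ∀ {x} → x < N → Xcyc N x ≡ suc x
    X-< {x} x<N = cong (λ b → if b then suc x else 0) (<⇒<ᵇ-true x<N)

    X-∈ : ∀ {x} → x ≤ N → Xcyc N x ∈ 0 ∷ π
    X-∈ {x} x≤N with x ≟ N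
    ... | yes refl rewrite X-top = here refl
    ... | no x≢N rewrite X-< (≤∧≢⇒< x≤N x≢N) = there (complete π-perm (s≤s z≤n , ≤∧≢⇒< x≤N x≢N))

    X-injective : ∀ {x y} → x ≤ N → y ≤ N → Xcyc N x ≡ Xcyc N y → x ≡ y
    X-injective {x} {y} x≤N y≤N e with x ≟ N | y ≟ N
    ... | yes refl | yes refl = refl
    ... | yes refl | no y≢N with () ← trans (sym X-top) (trans e (X-< (≤∧≢⇒< y≤N y≢N)))
    ... | no x≢N | yes refl with () ← trans (sym X-top) (trans (sym e) (X-< (≤∧≢⇒< x≤N x≢N)))
    ... | no x≢N | no y≢N = suc-injective (trans (sym (X-< (≤∧≢⇒< x≤N x≢N))) (trans e (X-< (≤∧≢⇒< y≤N y≢N))))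

    C≡ : ∀ x → C x ≡ predIn ℓ (0 ∷ π) (Xcyc N x)
    C≡ x = cong (λ L → Ycyc π (Xcyc L x)) (length≡ π-perm)

    C-closed : ∀ {x} → x ≤ N → C x ≤ N
    C-closed {x} x≤N with predecessors⊆ ℓ (0 ∷ π) (predIn-∈-predecessors ℓ (0 ∷ π) (X-∈ x≤N))
    ... | here e = subst (_≤ N) (sym (trans (C≡ x) e))
      (ℓ≤N (subst (_∈ 0 ∷ π) (sym (fromMaybe-last≡lastOr 0 π)) (lastOr-∈ 0 π)))
      where ℓ≤N : ∀ {z} → z ∈ 0 ∷ π → z ≤ N
            ℓ≤N (here refl) = z≤n
            ℓ≤N (there z∈) = proj₂ (bounded π-perm z∈)
    ... | there (here e) = subst (_≤ N) (sym (trans (C≡ x) e)) z≤n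
    ... | there (there z∈) = subst (_≤ N) (sym (C≡ x)) (proj₂ (bounded π-perm z∈))

    C-injective : ∀ {x y} → x ≤ N → y ≤ N → C x ≡ C y → x ≡ y
    C-injective {x} {y} x≤N y≤N e = X-injective x≤N y≤N
      (predIn-injective ℓ (0 ∷ π) preds! (X-∈ x≤N) (X-∈ y≤N) (trans (sym (C≡ x)) (trans e (C≡ y))))

    open IterateOn (_≤ N) C C-closed C-injective

    z : ℕ → ℕ
    z i = C ^[ i ] (C N)

    z-inRange : ∀ {i} → i < m → InRange m (z i)
    z-inRange {i} i<m with z≢0 , z≢N ← proj₁ reaches-0 i i<m =
      n≢0⇒n>0 z≢0 , s≤s⁻¹ (≤∧≢⇒< (^[]-closed i (C-closed ≤-refl)) z≢N)

    no-shorter-return : ∀ {i j} → i < j → j < m → z i ≡ z j → ⊥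
    no-shorter-return {i} {j} i<j j<m e = proj₂ (proj₁ reaches-0 d′ d′<m) (trans (sym (^[]-comm C d′ N)) Cᵈ⁺¹N≡N)
      where
      d′ : ℕ
      d′ = j ∸ i ∸ 1
      1+d′≡j-i : suc d′ ≡ j ∸ i
      1+d′≡j-i = m+[n∸m]≡n (m<n⇒0<n∸m i<j)
      d′<m : d′ < m
      d′<m = ≤-<-trans (≤-trans (n≤1+n d′) (≤-reflexive 1+d′≡j-i)) (≤-<-trans (m∸n≤m j i) j<m)
      Cᵈ⁺¹N≡N : C ^[ suc d′ ] N ≡ N
      Cᵈ⁺¹N≡N = C-injective (^[]-closed (suc d′) ≤-refl) ≤-refl (begin
        C (C ^[ suc d′ ] N) ≡⟨ ^[]-comm C (suc d′) N ⟩
        C ^[ suc d′ ] (C N) ≡⟨ cong (λ k → C ^[ k ] (C N)) 1+d′≡j-i ⟩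
        C ^[ j ∸ i ] (C N)  ≡⟨ ^[]-return (C-closed ≤-refl) (<⇒≤ i<j) e ⟩
        C N                 ∎)
        where open ≡-Reasoning

    z-injective : ∀ {i j} → i < m → j < m → z i ≡ z j → i ≡ j
    z-injective {i} {j} i<m j<m e with <-cmp i j
    ... | tri≈ _ i≡j _ = i≡j
    ... | tri< i<j _ _ = ⊥-elim (no-shorter-return i<j j<m e)
    ... | tri> _ _ j<i = ⊥-elim (no-shorter-return j<i i<m (sym e))

    C0≢C-orbit : ∀ {k} → k < m → C 0 ≢ C (z k)
    C0≢C-orbit {k} k<m e = proj₁ (proj₁ reaches-0 k k<m) (sym (C-injective z≤n (^[]-closed k (C-closed ≤-refl)) e))

    C0≡N : C 0 ≡ N
    C0≡N with C 0 ≟ 0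
    ... | yes C0≡0 = ⊥-elim (C0≢C-orbit (subst (m ∸ 1 <_) 1+m′≡m ≤-refl)
            (trans C0≡0 (sym (trans (cong (λ k → C ^[ k ] (C N)) 1+m′≡m) (proj₂ reaches-0)))))
      where
      1+m′≡m : suc (m ∸ 1) ≡ m
      1+m′≡m = m+[n∸m]≡n 1≤m
    ... | no C0≢0 with C 0 ≤? m
    ...   | no C0≰m = ≤-antisym (C-closed z≤n) (≰⇒> C0≰m)
    ...   | yes C0≤m with injection-covers z z-injective z-inRange (n≢0⇒n>0 C0≢0 , C0≤m)
    ...     | zero , _ , CN≡C0 with () ← C-injective z≤n ≤-refl (sym CN≡C0)
    ...     | suc k , 1+k<m , Czₖ≡C0 = ⊥-elim (C0≢C-orbit (≤-trans (n≤1+n (suc k)) 1+k<m) (sym Czₖ≡C0))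

  maxPile⇒adjacent : ∃[ A ] ∃[ B ] π ≡ A ++ suc m ∷ 1 ∷ B
  maxPile⇒adjacent = predIn≡⇒adjacent π (unique π-perm) predIn-1≡N (λ ()) (λ e → <-irrefl (sym (suc-injective e)) 1≤m)
    where
    predIn-1≡N : predIn 0 π 1 ≡ N
    predIn-1≡N = trans (sym (predIn-≢ {ℓ} π (λ ()))) (trans (cong (predIn ℓ (0 ∷ π)) (sym (X-< (s≤s z≤n))))
                   (trans (sym (C≡ 0)) C0≡N))

-- Valid pointer contexts

selects : ℕ → ℕ → ℕ → Bool
selects p q y = does (y ≟ p) ∨ does (y ≟ q)

interleaves : List ℕ → ℕ → ℕ → Bool
interleaves w p q =
  does (≡-dec _≟_ r (p ∷ q ∷ p ∷ q ∷ [])) ∨ does (≡-dec _≟_ r (q ∷ p ∷ q ∷ p ∷ []))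
  where
  r : List ℕ
  r = filterᵇ (selects p q) w

countContexts≡upperSum : ∀ π → countContexts π ≡ upperSum (interleaves (pointerWord π)) (length π ∸ 1)
countContexts≡upperSum π = refl

private

  does-⇔ : ∀ {P Q : Set} (P? : Dec P) (Q? : Dec Q) → (P → Q) → (Q → P) → does P? ≡ does Q?
  does-⇔ (yes _) (yes _) _ _ = refl
  does-⇔ (yes p) (no ¬q) f _ = ⊥-elim (¬q (f p))
  does-⇔ (no ¬p) (yes q) _ g = ⊥-elim (¬p (g q))
  does-⇔ (no _) (no _) _ _ = refl

  filterᵇ-∷ : ∀ (s : ℕ → Bool) x xs → filterᵇ s (x ∷ xs) ≡ (if s x then x ∷ filterᵇ s xs else filterᵇ s xs)
  filterᵇ-∷ s x xs with s x
  ... | true = refl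
  ... | false = refl

  filterᵇ-cong : ∀ {s t : ℕ → Bool} xs → (∀ {x} → x ∈ xs → s x ≡ t x) → filterᵇ s xs ≡ filterᵇ t xs
  filterᵇ-cong {s} {t} [] _ = refl
  filterᵇ-cong {s} {t} (x ∷ xs) s≡t
    rewrite filterᵇ-∷ s x xs | filterᵇ-∷ t x xs | s≡t (here refl) | filterᵇ-cong xs (s≡t ∘ there) = refl

interleaves-sym : ∀ w p q → interleaves w p q ≡ interleaves w q p
interleaves-sym w p q
  rewrite filterᵇ-cong {selects p q} {selects q p} w (λ {y} _ → ∨-comm (does (y ≟ p)) (does (y ≟ q))) =
  ∨-comm (does (≡-dec _≟_ (filterᵇ (selects q p) w) (p ∷ q ∷ p ∷ q ∷ []))) _

private
  pattern-rotate : ∀ c r p q →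
    does (≡-dec _≟_ (r ++ c ∷ []) (p ∷ q ∷ p ∷ q ∷ [])) ∨ does (≡-dec _≟_ (r ++ c ∷ []) (q ∷ p ∷ q ∷ p ∷ [])) ≡
    does (≡-dec _≟_ (c ∷ r) (p ∷ q ∷ p ∷ q ∷ [])) ∨ does (≡-dec _≟_ (c ∷ r) (q ∷ p ∷ q ∷ p ∷ []))
  pattern-rotate c r p q =
    trans (cong₂ _∨_ (does-⇔ (≡-dec _≟_ _ _) (≡-dec _≟_ _ _) (⇒ p q) (⇐ p q))
                     (does-⇔ (≡-dec _≟_ _ _) (≡-dec _≟_ _ _) (⇒ q p) (⇐ q p)))
          (∨-comm (does (≡-dec _≟_ (c ∷ r) (q ∷ p ∷ q ∷ p ∷ []))) _)
    where
    ⇒ : ∀ p q → r ++ c ∷ [] ≡ p ∷ q ∷ p ∷ q ∷ [] → c ∷ r ≡ q ∷ p ∷ q ∷ p ∷ []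
    ⇒ p q e with refl , refl ← ∷ʳ-injective r (p ∷ q ∷ p ∷ []) e = refl
    ⇐ : ∀ p q → c ∷ r ≡ q ∷ p ∷ q ∷ p ∷ [] → r ++ c ∷ [] ≡ p ∷ q ∷ p ∷ q ∷ []
    ⇐ p q refl = refl

interleaves-rotate : ∀ w p q → interleaves (rotate w) p q ≡ interleaves w p q
interleaves-rotate [] p q = refl
interleaves-rotate (c ∷ w) p q
  rewrite filter-++ (T? ∘ selects p q) w (c ∷ []) | filterᵇ-∷ (selects p q) c w | filterᵇ-∷ (selects p q) c []
  with selects p q c
... | true = pattern-rotate c (filterᵇ (selects p q) w) p q
... | false rewrite ++-identityʳ (filterᵇ (selects p q) w) = refl

module _ {P : ℕ → Set} (g : ℕ → ℕ) (g-injective : ∀ {x y} → P x → P y → g x ≡ g y → x ≡ y) where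

  private
    selects-map : ∀ {p q y} → P p → P q → P y → selects (g p) (g q) (g y) ≡ selects p q y
    selects-map p∈ q∈ y∈ = cong₂ _∨_
      (does-⇔ (_ ≟ _) (_ ≟ _) (g-injective y∈ p∈) (cong g))
      (does-⇔ (_ ≟ _) (_ ≟ _) (g-injective y∈ q∈) (cong g))

    filter-map : ∀ w {p q} → All P w → P p → P q →
      filterᵇ (selects (g p) (g q)) (map g w) ≡ map g (filterᵇ (selects p q) w)
    filter-map [] _ _ _ = refl
    filter-map (y ∷ w) {p} {q} (y∈ ∷ w∈) p∈ q∈
      rewrite filterᵇ-∷ (selects (g p) (g q)) (g y) (map g w) | filterᵇ-∷ (selects p q) y w
            | selects-map p∈ q∈ y∈ with selects p q y
    ... | true = cong (g y ∷_) (filter-map w w∈ p∈ q∈)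
    ... | false = filter-map w w∈ p∈ q∈

    map-injectiveOn : ∀ xs ys → All P xs → All P ys → map g xs ≡ map g ys → xs ≡ ys
    map-injectiveOn [] [] _ _ _ = refl
    map-injectiveOn (x ∷ xs) (y ∷ ys) (x∈ ∷ xs∈) (y∈ ∷ ys∈) e with gx≡gy , e′ ← ∷-injective e =
      cong₂ _∷_ (g-injective x∈ y∈ gx≡gy) (map-injectiveOn xs ys xs∈ ys∈ e′)

  interleaves-map : ∀ w {p q} → All P w → P p → P q → interleaves (map g w) (g p) (g q) ≡ interleaves w p q
  interleaves-map w {p} {q} w∈ p∈ q∈ rewrite filter-map w w∈ p∈ q∈ = cong₂ _∨_
    (does-⇔ (≡-dec _≟_ _ _) (≡-dec _≟_ _ _) (map-injectiveOn r _ r∈ (p∈ ∷ q∈ ∷ p∈ ∷ q∈ ∷ [])) (cong (map g)))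
    (does-⇔ (≡-dec _≟_ _ _) (≡-dec _≟_ _ _) (map-injectiveOn r _ r∈ (q∈ ∷ p∈ ∷ q∈ ∷ p∈ ∷ [])) (cong (map g)))
    where
    r : List ℕ
    r = filterᵇ (selects p q) w
    r∈ : All P r
    r∈ = Allₚ.filter⁺ (T? ∘ selects p q) w∈

leftPointer : ℕ → ℕ → ℕ
leftPointer m x = if x ≡ᵇ 1 then m else x ∸ 1

-- W(expand m σ): the entry 2n keeps only its left pointer (2n − 1, 2n) = m, which takes the place of
-- the removed left pointer (0, 1) of the following 1.  So pointers of σ are read modulo m.
cyclicPointerWord : ℕ → List ℕ → List ℕ
cyclicPointerWord m [] = []
cyclicPointerWord m (x ∷ xs) = leftPointer m x ∷ x ∷ cyclicPointerWord m xs

module _ {m : ℕ} where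

  leftPointer-cyclicSuc : ∀ {x} → InRange m x → leftPointer m (cyclicSuc m x) ≡ x
  leftPointer-cyclicSuc {x} (1≤x , _) with x ≟ m
  ... | yes refl rewrite cyclicSuc-top {m} = refl
  ... | no x≢m rewrite cyclicSuc-≢ x≢m | ≢⇒≡ᵇ-false {suc x} {1} (λ e → <-irrefl (sym (suc-injective e)) 1≤x) = refl

  cyclicSuc-leftPointer : ∀ {x} → InRange m x → cyclicSuc m (leftPointer m x) ≡ x
  cyclicSuc-leftPointer {x} (1≤x , x≤m) with x ≟ 1
  ... | yes refl = cyclicSuc-top
  ... | no x≢1 rewrite ≢⇒≡ᵇ-false x≢1 =
    trans (cyclicSuc-≢ (λ e → <-irrefl e (<-≤-trans (≤-reflexive (m+[n∸m]≡n 1≤x)) x≤m))) (m+[n∸m]≡n 1≤x)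

  leftPointer-inRange : ∀ {x} → InRange m x → InRange m (leftPointer m x)
  leftPointer-inRange {x} x∈ with y , y∈ , refl ← cyclicSuc-surjective x∈ =
    subst (InRange m) (sym (leftPointer-cyclicSuc y∈)) y∈

  cyclicPointerWord-inRange : ∀ {σ} → All (InRange m) σ → All (InRange m) (cyclicPointerWord m σ)
  cyclicPointerWord-inRange [] = []
  cyclicPointerWord-inRange (x∈ ∷ σ∈) = leftPointer-inRange x∈ ∷ x∈ ∷ cyclicPointerWord-inRange σ∈

  cyclicPointerWord-map : ∀ {σ} → All (InRange m) σ →
    cyclicPointerWord m (map (cyclicSuc m) σ) ≡ map (cyclicSuc m) (cyclicPointerWord m σ)
  cyclicPointerWord-map [] = refl
  cyclicPointerWord-map {x ∷ σ} (x∈ ∷ σ∈) =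
    cong₂ _∷_ (trans (leftPointer-cyclicSuc x∈) (sym (cyclicSuc-leftPointer x∈)))
              (cong (cyclicSuc m x ∷_) (cyclicPointerWord-map σ∈))

  cyclicPointerWord-++ : ∀ xs ys → cyclicPointerWord m (xs ++ ys) ≡ cyclicPointerWord m xs ++ cyclicPointerWord m ys
  cyclicPointerWord-++ [] ys = refl
  cyclicPointerWord-++ (x ∷ xs) ys = cong (λ w → leftPointer m x ∷ x ∷ w) (cyclicPointerWord-++ xs ys)

  cyclicPointerWord-rotate : ∀ σ → cyclicPointerWord m (rotate σ) ≡ rotate (rotate (cyclicPointerWord m σ))
  cyclicPointerWord-rotate [] = refl
  cyclicPointerWord-rotate (x ∷ xs) =
    trans (cyclicPointerWord-++ xs (x ∷ [])) (sym (++-assoc (cyclicPointerWord m xs) (leftPointer m x ∷ []) (x ∷ [])))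

private
  dropBoundary : ℕ → List ℕ → List ℕ
  dropBoundary N w = filter (λ p → ¬? (p ≟ 0)) (filter (λ p → ¬? (p ≟ N)) w)

  dropBoundary-keep : ∀ N {x} xs → x ≢ 0 → x ≢ N → dropBoundary N (x ∷ xs) ≡ x ∷ dropBoundary N xs
  dropBoundary-keep N {x} xs x≢0 x≢N
    rewrite filter-accept (λ p → ¬? (p ≟ N)) {x} {xs} x≢N = filter-accept (λ p → ¬? (p ≟ 0)) x≢0

  dropBoundary-N : ∀ N xs → dropBoundary N (N ∷ xs) ≡ dropBoundary N xs
  dropBoundary-N N xs rewrite filter-reject (λ p → ¬? (p ≟ N)) {N} {xs} (λ N≢N → N≢N refl) = refl

  dropBoundary-0 : ∀ N xs → dropBoundary N (0 ∷ xs) ≡ dropBoundary N xs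
  dropBoundary-0 zero xs = dropBoundary-N 0 xs
  dropBoundary-0 (suc N) xs rewrite filter-accept (λ p → ¬? (p ≟ suc N)) {0} {xs} (λ ()) =
    filter-reject (λ p → ¬? (p ≟ 0)) {0} {filter (λ p → ¬? (p ≟ suc N)) xs} (λ 0≢0 → 0≢0 refl)

  rawPointers : List ℕ → List ℕ
  rawPointers = concatMap (λ x → (x ∸ 1) ∷ x ∷ [])

  dropBoundary-expand : ∀ {m σ} → 1 ≤ m → All (InRange m) σ →
    dropBoundary (suc m) (rawPointers (expand m σ)) ≡ cyclicPointerWord m σ
  dropBoundary-expand {m} {[]} _ _ = refl
  dropBoundary-expand {m} {x ∷ σ} 1≤m ((1≤x , x≤m) ∷ σ∈) with x ≟ 1
  ... | yes refl = begin
    dropBoundary (suc m) (m ∷ suc m ∷ 0 ∷ 1 ∷ rest)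
      ≡⟨ dropBoundary-keep (suc m) (suc m ∷ 0 ∷ 1 ∷ rest) (λ e → <-irrefl (sym e) 1≤m) (λ e → <-irrefl e ≤-refl) ⟩
    m ∷ dropBoundary (suc m) (suc m ∷ 0 ∷ 1 ∷ rest) ≡⟨ cong (m ∷_) (dropBoundary-N (suc m) (0 ∷ 1 ∷ rest)) ⟩
    m ∷ dropBoundary (suc m) (0 ∷ 1 ∷ rest)         ≡⟨ cong (m ∷_) (dropBoundary-0 (suc m) (1 ∷ rest)) ⟩
    m ∷ dropBoundary (suc m) (1 ∷ rest)
      ≡⟨ cong (m ∷_) (dropBoundary-keep (suc m) rest (λ ()) (λ e → <-irrefl (suc-injective e) 1≤m)) ⟩
    m ∷ 1 ∷ dropBoundary (suc m) rest               ≡⟨ cong (λ w → m ∷ 1 ∷ w) (dropBoundary-expand 1≤m σ∈) ⟩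
    m ∷ 1 ∷ cyclicPointerWord m σ                   ∎
    where
    open ≡-Reasoning
    rest : List ℕ
    rest = rawPointers (expand m σ)
  ... | no x≢1 rewrite ≢⇒≡ᵇ-false x≢1 = begin
    dropBoundary (suc m) (x ∸ 1 ∷ x ∷ rest)
      ≡⟨ dropBoundary-keep (suc m) (x ∷ rest) (λ e → <-irrefl (sym e) 1≤x-1)
           (λ e → <-irrefl e (s≤s (≤-trans (m∸n≤m x 1) x≤m))) ⟩
    x ∸ 1 ∷ dropBoundary (suc m) (x ∷ rest)
      ≡⟨ cong (x ∸ 1 ∷_) (dropBoundary-keep (suc m) rest (λ e → <-irrefl (sym e) 1≤x) (λ e → <-irrefl e (s≤s x≤m))) ⟩
    x ∸ 1 ∷ x ∷ dropBoundary (suc m) rest   ≡⟨ cong (λ w → x ∸ 1 ∷ x ∷ w) (dropBoundary-expand 1≤m σ∈) ⟩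
    x ∸ 1 ∷ x ∷ cyclicPointerWord m σ       ∎
    where
    open ≡-Reasoning
    rest : List ℕ
    rest = rawPointers (expand m σ)
    1≤x-1 : 1 ≤ x ∸ 1
    1≤x-1 = s≤s⁻¹ (subst (2 ≤_) (sym (m+[n∸m]≡n 1≤x)) (≤∧≢⇒< 1≤x (x≢1 ∘ sym)))

contextRelation : ℕ → List ℕ → ℕ → ℕ → Bool
contextRelation m σ = interleaves (cyclicPointerWord m σ)

countContexts-expand : ∀ {m σ} → IsPerm m σ → 1 ≤ m → countContexts (expand m σ) ≡ upperSum (contextRelation m σ) m
countContexts-expand {m} {σ} σ-perm 1≤m = trans (countContexts≡upperSum (expand m σ)) (
  cong₂ (λ N w → upperSum (interleaves w) (N ∸ 1)) expand-length≡
    (trans (cong (λ N → dropBoundary N (rawPointers (expand m σ))) expand-length≡)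
           (dropBoundary-expand 1≤m (All.tabulate (bounded σ-perm)))))
  where
  expand-length≡ : length (expand m σ) ≡ suc m
  expand-length≡ = expand-length σ-perm 1≤m

contextRelation-rotate^[] : ∀ m a σ p q → contextRelation m (rotate ^[ a ] σ) p q ≡ contextRelation m σ p q
contextRelation-rotate^[] m zero σ p q = refl
contextRelation-rotate^[] m (suc a) σ p q = begin
  interleaves (cyclicPointerWord m (rotate (rotate ^[ a ] σ))) p q
    ≡⟨ cong (λ w → interleaves w p q) (cyclicPointerWord-rotate (rotate ^[ a ] σ)) ⟩
  interleaves (rotate (rotate (cyclicPointerWord m (rotate ^[ a ] σ)))) p q
    ≡⟨ interleaves-rotate (rotate (cyclicPointerWord m (rotate ^[ a ] σ))) p q ⟩
  interleaves (rotate (cyclicPointerWord m (rotate ^[ a ] σ))) p q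
    ≡⟨ interleaves-rotate (cyclicPointerWord m (rotate ^[ a ] σ)) p q ⟩
  contextRelation m (rotate ^[ a ] σ) p q
    ≡⟨ contextRelation-rotate^[] m a σ p q ⟩
  contextRelation m σ p q
    ∎
  where open ≡-Reasoning

module _ {m : ℕ} where

  contextRelation-cyclicSuc : ∀ {σ} → All (InRange m) σ → ∀ {p q} → InRange m p → InRange m q →
    contextRelation m (map (cyclicSuc m) σ) (cyclicSuc m p) (cyclicSuc m q) ≡ contextRelation m σ p q
  contextRelation-cyclicSuc {σ} σ∈ p∈ q∈ =
    trans (cong (λ w → interleaves w _ _) (cyclicPointerWord-map σ∈))
          (interleaves-map (cyclicSuc m) cyclicSuc-injective (cyclicPointerWord m σ)
            (cyclicPointerWord-inRange σ∈) p∈ q∈)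

  contextRelation-cyclicSuc^[] : ∀ b {σ} → All (InRange m) σ → ∀ {p q} → InRange m p → InRange m q →
    contextRelation m (map (cyclicSuc m ^[ b ]_) σ) (cyclicSuc m ^[ b ] p) (cyclicSuc m ^[ b ] q) ≡
    contextRelation m σ p q
  contextRelation-cyclicSuc^[] zero {σ} _ _ _ = cong (λ τ → contextRelation m τ _ _) (map-id σ)
  contextRelation-cyclicSuc^[] (suc b) {σ} σ∈ {p} {q} p∈ q∈ = begin
    contextRelation m (map (cyclicSuc m ^[ suc b ]_) σ) (cyclicSuc m ^[ suc b ] p) (cyclicSuc m ^[ suc b ] q)
      ≡⟨ cong (λ τ → contextRelation m τ (cyclicSuc m ^[ suc b ] p) (cyclicSuc m ^[ suc b ] q)) (map-∘ σ) ⟩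
    contextRelation m (map (cyclicSuc m) (map (cyclicSuc m ^[ b ]_) σ))
      (cyclicSuc m ^[ suc b ] p) (cyclicSuc m ^[ suc b ] q)
      ≡⟨ contextRelation-cyclicSuc (Allₚ.map⁺ (All.map (^[]-closed b) σ∈)) (^[]-closed b p∈) (^[]-closed b q∈) ⟩
    contextRelation m (map (cyclicSuc m ^[ b ]_) σ) (cyclicSuc m ^[ b ] p) (cyclicSuc m ^[ b ] q)
      ≡⟨ contextRelation-cyclicSuc^[] b σ∈ p∈ q∈ ⟩
    contextRelation m σ p q
      ∎
    where
    open ≡-Reasoning
    open CyclicSuc m using (^[]-closed)

  private
    upperSum-cong : ∀ {I J : ℕ → ℕ → Bool} → (∀ p q → I p q ≡ J p q) → upperSum I m ≡ upperSum J m
    upperSum-cong I≡J = cong sum (map-cong (λ p → cong sum (map-cong (λ q → cong indicator (I≡J p q))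
      (map (λ j → p + suc j) (upTo (m ∸ p))))) (oneToN m))

    relabel-invariant : ∀ {I J : ℕ → ℕ → Bool} →
      (∀ {p q} → InRange m p → InRange m q → J (cyclicSuc m p) (cyclicSuc m q) ≡ I p q) →
      (∀ p q → I p q ≡ I q p) → (∀ p q → J p q ≡ J q p) → upperSum J m ≡ upperSum I m
    relabel-invariant {I} {J} J∘suc≡I I-sym J-sym = *-cancelˡ-≡ (upperSum J m) (upperSum I m) 2
      (+-cancelʳ-≡ (diagonalSum I m) _ _ (begin
        2 * upperSum J m + diagonalSum I m ≡⟨ cong (2 * upperSum J m +_) diagonal≡ ⟨
        2 * upperSum J m + diagonalSum J m ≡⟨ fullSum≡2*upperSum+diagonalSum J J-sym m ⟨
        fullSum J m                        ≡⟨ full≡ ⟩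
        fullSum I m                        ≡⟨ fullSum≡2*upperSum+diagonalSum I I-sym m ⟩
        2 * upperSum I m + diagonalSum I m ∎))
      where
      open ≡-Reasoning
      full≡ : fullSum J m ≡ fullSum I m
      full≡ = trans (sym (sumTo-cyclicSuc^[] m 1 (λ p → sumTo m (λ q → indicator (J p q)))))
        (sumTo-cong m (λ {p} p∈ → trans (sym (sumTo-cyclicSuc^[] m 1 (λ q → indicator (J (cyclicSuc m p) q))))
          (sumTo-cong m (λ q∈ → cong indicator (J∘suc≡I p∈ q∈)))))
      diagonal≡ : diagonalSum J m ≡ diagonalSum I m
      diagonal≡ = trans (sym (sumTo-cyclicSuc^[] m 1 (λ p → indicator (J p p))))
        (sumTo-cong m (λ p∈ → cong indicator (J∘suc≡I p∈ p∈)))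

  countContexts-rotate : ∀ {σ} → IsPerm m σ → IsPerm m (rotate σ) → 1 ≤ m →
    countContexts (expand m (rotate σ)) ≡ countContexts (expand m σ)
  countContexts-rotate {σ} σ-perm rσ-perm 1≤m = begin
    countContexts (expand m (rotate σ))      ≡⟨ countContexts-expand rσ-perm 1≤m ⟩
    upperSum (contextRelation m (rotate σ)) m ≡⟨ upperSum-cong (contextRelation-rotate^[] m 1 σ) ⟩
    upperSum (contextRelation m σ) m         ≡⟨ countContexts-expand σ-perm 1≤m ⟨
    countContexts (expand m σ)               ∎
    where open ≡-Reasoning

  countContexts-cyclicSuc : ∀ {σ} → IsPerm m σ → IsPerm m (map (cyclicSuc m) σ) → 1 ≤ m →
    countContexts (expand m (map (cyclicSuc m) σ)) ≡ countContexts (expand m σ)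
  countContexts-cyclicSuc {σ} σ-perm sσ-perm 1≤m = begin
    countContexts (expand m (map (cyclicSuc m) σ))       ≡⟨ countContexts-expand sσ-perm 1≤m ⟩
    upperSum (contextRelation m (map (cyclicSuc m) σ)) m
      ≡⟨ relabel-invariant (contextRelation-cyclicSuc (All.tabulate (bounded σ-perm)))
           (interleaves-sym (cyclicPointerWord m σ)) (interleaves-sym (cyclicPointerWord m (map (cyclicSuc m) σ))) ⟩
    upperSum (contextRelation m σ) m                    ≡⟨ countContexts-expand σ-perm 1≤m ⟨
    countContexts (expand m σ)                          ∎
    where open ≡-Reasoning

module _ {m b : ℕ} (I : ℕ → ℕ → Bool) (I-sym : ∀ p q → I p q ≡ I q p)
  (invariant : ∀ {p q} → InRange m p → InRange m q → I (cyclicSuc m ^[ b ] p) (cyclicSuc m ^[ b ] q) ≡ I p q) where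

  invariant⇒∣2*upperSum : ∀ {t} → m ≡ t * gcd b m → t ∣ 2 * upperSum I m
  invariant⇒∣2*upperSum {t} m≡td = ∣m+n∣m⇒∣n (subst (t ∣_) full≡ t∣full) t∣diagonal
    where
    row : ℕ → ℕ
    row p = sumTo m (λ q → indicator (I p q))
    row-invariant : ∀ {p} → InRange m p → row (cyclicSuc m ^[ b ] p) ≡ row p
    row-invariant p∈ = trans (sym (sumTo-cyclicSuc^[] m b _)) (sumTo-cong m (λ q∈ → cong indicator (invariant p∈ q∈)))
    t∣full : t ∣ fullSum I m
    t∣full = cyclicSuc-invariant⇒∣sumTo {m} {b} row row-invariant m≡td
    t∣diagonal : t ∣ diagonalSum I m
    t∣diagonal = cyclicSuc-invariant⇒∣sumTo {m} {b} (λ p → indicator (I p p))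
      (λ p∈ → cong indicator (invariant p∈ p∈)) m≡td
    full≡ : fullSum I m ≡ diagonalSum I m + 2 * upperSum I m
    full≡ = trans (fullSum≡2*upperSum+diagonalSum I I-sym m) (+-comm (2 * upperSum I m) _)

-- The action of ℤ_m × ℤ_m

act : ℕ → ℕ × ℕ → List ℕ → List ℕ
act m (a , b) σ = rotate ^[ a ] (map (cyclicSuc m ^[ b ]_) σ)

act-compose : ∀ m a b c d σ → act m (a , b) (act m (c , d) σ) ≡ act m (a + c , b + d) σ
act-compose m a b c d σ = begin
  rotate ^[ a ] (map (f ^[ b ]_) (rotate ^[ c ] (map (f ^[ d ]_) σ)))
    ≡⟨ cong (rotate ^[ a ]_) (rotate^[]-map c (f ^[ b ]_) (map (f ^[ d ]_) σ)) ⟨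
  rotate ^[ a ] (rotate ^[ c ] (map (f ^[ b ]_) (map (f ^[ d ]_) σ)))
    ≡⟨ ^[+] rotate a c _ ⟨
  rotate ^[ a + c ] (map (f ^[ b ]_) (map (f ^[ d ]_) σ))
    ≡⟨ cong (rotate ^[ a + c ]_) (map-∘ σ) ⟨
  rotate ^[ a + c ] (map (λ x → f ^[ b ] (f ^[ d ] x)) σ)
    ≡⟨ cong (rotate ^[ a + c ]_) (map-cong (λ x → ^[+] f b d x) σ) ⟨
  rotate ^[ a + c ] (map (f ^[ b + d ]_) σ)
    ∎
  where
  open ≡-Reasoning
  f : ℕ → ℕ
  f = cyclicSuc m

act-zero : ∀ m σ → act m (0 , 0) σ ≡ σ
act-zero m σ = map-id σ

act-% : ∀ {m σ} .{{_ : NonZero m}} → IsPerm m σ → ∀ a b → act m (a , b) σ ≡ act m (a % m , b % m) σ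
act-% {m} {σ} σ-perm a b = begin
  rotate ^[ a ] (map (cyclicSuc m ^[ b ]_) σ)             ≡⟨ ^[%]-fixed rotate rotate^[m] a ⟩
  rotate ^[ a % m ] (map (cyclicSuc m ^[ b ]_) σ)
    ≡⟨ cong (rotate ^[ a % m ]_) (map-cong-local (All.tabulate
         (λ x∈ → ^[%]-fixed (cyclicSuc m) (cyclicSuc^[m] (bounded σ-perm x∈)) b))) ⟩
  rotate ^[ a % m ] (map (cyclicSuc m ^[ b % m ]_) σ)     ∎
  where
  open ≡-Reasoning
  τ : List ℕ
  τ = map (cyclicSuc m ^[ b ]_) σ
  rotate^[m] : rotate ^[ m ] τ ≡ τ
  rotate^[m] = subst (λ k → rotate ^[ k ] τ ≡ τ) (trans (length-map _ σ) (length≡ σ-perm)) (rotate^[length] τ)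

module Corollary (n k : ℕ) (n≥2 : n ≥ 2) (k⊥m : Coprime k (2 * n ∸ 1)) where

  m : ℕ
  m = 2 * n ∸ 1

  2n≡1+m : 2 * n ≡ suc m
  2n≡1+m = sym (m+[n∸m]≡n (≤-trans (s≤s z≤n) (*-monoʳ-≤ 2 n≥2)))

  1≤m : 1 ≤ m
  1≤m = s≤s⁻¹ (≤-trans (s≤s (s≤s z≤n)) (subst (4 ≤_) 2n≡1+m (*-monoʳ-≤ 2 n≥2)))

  instance
    m≢0 : NonZero m
    m≢0 = >-nonZero 1≤m

  ¬2∣m : ¬ 2 ∣ m
  ¬2∣m 2∣m with s≤s () ← ∣⇒≤ (∣m+n∣m⇒∣n (subst (2 ∣_) (trans 2n≡1+m (+-comm 1 m)) (m∣m*n n)) 2∣m)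

  M : List ℕ → Set
  M σ = σ ↭ oneToN m × length (strategicPile (expand m σ)) ≡ m × countContexts (expand m σ) ≡ k

  M-rotate : ∀ {σ} → M σ → M (rotate σ)
  M-rotate {σ} (σ↭ , pile , contexts) =
    rσ↭ , IsMCycle⇒maxPile rσ-perm 1≤m (IsMCycle-rotate σ-perm 1≤m (maxPile⇒IsMCycle σ-perm 1≤m pile)) ,
    trans (countContexts-rotate σ-perm rσ-perm 1≤m) contexts
    where
    σ-perm : IsPerm m σ
    σ-perm = ↭⇒IsPerm σ↭
    rσ↭ : rotate σ ↭ oneToN m
    rσ↭ = ↭-trans (rotate-↭ σ) σ↭
    rσ-perm : IsPerm m (rotate σ)
    rσ-perm = ↭⇒IsPerm rσ↭

  M-cyclicSuc : ∀ {σ} → M σ → M (map (cyclicSuc m) σ)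
  M-cyclicSuc {σ} (σ↭ , pile , contexts) =
    sσ↭ , IsMCycle⇒maxPile sσ-perm 1≤m (IsMCycle-cyclicSuc σ-perm 1≤m (maxPile⇒IsMCycle σ-perm 1≤m pile)) ,
    trans (countContexts-cyclicSuc σ-perm sσ-perm 1≤m) contexts
    where
    σ-perm : IsPerm m σ
    σ-perm = ↭⇒IsPerm σ↭
    sσ↭ : map (cyclicSuc m) σ ↭ oneToN m
    sσ↭ = ↭-trans (map⁺ (cyclicSuc m) σ↭) (map-cyclicSuc-↭ m)
    sσ-perm : IsPerm m (map (cyclicSuc m) σ)
    sσ-perm = ↭⇒IsPerm sσ↭

  M-act : ∀ a b {σ} → M σ → M (act m (a , b) σ)
  M-act a b Mσ = rotations a (value-shifts b Mσ)
    where
    rotations : ∀ a {σ} → M σ → M (rotate ^[ a ] σ)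
    rotations zero Mσ = Mσ
    rotations (suc a) Mσ = M-rotate (rotations a Mσ)
    value-shifts : ∀ b {σ} → M σ → M (map (cyclicSuc m ^[ b ]_) σ)
    value-shifts zero {σ} Mσ = subst M (sym (map-id σ)) Mσ
    value-shifts (suc b) {σ} Mσ = subst M (sym (map-∘ σ)) (M-cyclicSuc (value-shifts b Mσ))

  stabilizer-trivial : ∀ {σ} → M σ → ∀ {a b} → a < m → b < m → act m (a , b) σ ≡ σ → a ≡ 0 × b ≡ 0
  stabilizer-trivial {σ} (σ↭ , _ , _) {a} {zero} a<m _ fixed with a ≟ 0
  ... | yes a≡0 = a≡0 , refl
  ... | no a≢0 = ⊥-elim (rotate^[]-moves (unique σ-perm) (n≢0⇒n>0 a≢0) (subst (a <_) (sym (length≡ σ-perm)) a<m)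
                          (trans (cong (rotate ^[ a ]_) (sym (map-id σ))) fixed))
    where
    σ-perm : IsPerm m σ
    σ-perm = ↭⇒IsPerm σ↭
  stabilizer-trivial {σ} (σ↭ , _ , contexts) {a} {b@(suc _)} _ b<m fixed
    with divides t m≡td ← gcd[m,n]∣n b m = ⊥-elim (<-irrefl (sym t≡1) (gcd-cofactor-≥2 (s≤s z≤n) b<m m≡td))
    where
    σ-perm : IsPerm m σ
    σ-perm = ↭⇒IsPerm σ↭
    I : ℕ → ℕ → Bool
    I = contextRelation m σ
    I-invariant : ∀ {p q} → InRange m p → InRange m q → I (cyclicSuc m ^[ b ] p) (cyclicSuc m ^[ b ] q) ≡ I p q
    I-invariant p∈ q∈ = trans (cong (λ τ → contextRelation m τ _ _) (sym fixed))
      (trans (contextRelation-rotate^[] m a _ _ _)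
             (contextRelation-cyclicSuc^[] b (All.tabulate (bounded σ-perm)) p∈ q∈))
    t∣m : t ∣ m
    t∣m = divides (gcd b m) (trans m≡td (*-comm t _))
    t∣k : t ∣ k
    t∣k = subst (t ∣_) (trans (sym (countContexts-expand σ-perm 1≤m)) contexts)
      (coprime-divisor (¬2∣⇒coprime-2 (¬2∣m ∘ (λ 2∣t → ∣-trans 2∣t t∣m)))
        (invariant⇒∣2*upperSum I (interleaves-sym (cyclicPointerWord m σ)) I-invariant m≡td))
    t≡1 : t ≡ 1
    t≡1 = k⊥m (t∣k , t∣m)

  shifts : List (ℕ × ℕ)
  shifts = cartesianProduct (upTo m) (upTo m)

  private
    ∈-shifts⁺ : ∀ {a b} → a < m → b < m → (a , b) ∈ shifts
    ∈-shifts⁺ a<m b<m = ∈-cartesianProduct⁺ (∈-upTo⁺ a<m) (∈-upTo⁺ b<m)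

    ∈-shifts⁻ : ∀ {a b} → (a , b) ∈ shifts → a < m × b < m
    ∈-shifts⁻ e∈ with a∈ , b∈ ← ∈-cartesianProduct⁻ (upTo m) (upTo m) e∈ = ∈-upTo⁻ a∈ , ∈-upTo⁻ b∈

    inverse : ℕ × ℕ → ℕ × ℕ
    inverse (a , b) = (m ∸ a) % m , (m ∸ b) % m

    inverse-act : ∀ {σ a b} → IsPerm m σ → a < m → b < m → act m (inverse (a , b)) (act m (a , b) σ) ≡ σ
    inverse-act {σ} {a} {b} σ-perm a<m b<m = begin
      act m (inverse (a , b)) (act m (a , b) σ)                 ≡⟨ act-compose m ((m ∸ a) % m) ((m ∸ b) % m) a b σ ⟩
      act m ((m ∸ a) % m + a , (m ∸ b) % m + b) σ               ≡⟨ act-% σ-perm _ _ ⟩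
      act m (((m ∸ a) % m + a) % m , ((m ∸ b) % m + b) % m) σ
        ≡⟨ cong₂ (λ c d → act m (c , d) σ) (cancels a<m) (cancels b<m) ⟩
      act m (0 , 0) σ                                           ≡⟨ act-zero m σ ⟩
      σ                                                         ∎
      where
      open ≡-Reasoning
      cancels : ∀ {a} → a < m → ((m ∸ a) % m + a) % m ≡ 0
      cancels {a} a<m = trans ([x%m+a]%m≡[x+a]%m (m ∸ a) a<m) (trans (cong (_% m) (m∸n+n≡m (<⇒≤ a<m))) (n%n≡0 m))

    shifts-identity : ∀ {σ} → M σ → ∃[ e ] e ∈ shifts × act m e σ ≡ σ
    shifts-identity {σ} _ = (0 , 0) , ∈-shifts⁺ 1≤m 1≤m , act-zero m σ

    shifts-inverse : ∀ {σ e} → M σ → e ∈ shifts → ∃[ e′ ] e′ ∈ shifts × act m e′ (act m e σ) ≡ σ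
    shifts-inverse {σ} {a , b} (σ↭ , _) e∈ with a<m , b<m ← ∈-shifts⁻ e∈ =
      inverse (a , b) , ∈-shifts⁺ (m%n<n _ m) (m%n<n _ m) , inverse-act (↭⇒IsPerm σ↭) a<m b<m

    shifts-compose : ∀ {σ e e′} → M σ → e ∈ shifts → e′ ∈ shifts →
      ∃[ e″ ] e″ ∈ shifts × act m e′ (act m e σ) ≡ act m e″ σ
    shifts-compose {σ} {a , b} {c , d} (σ↭ , _) _ _ =
      ((c + a) % m , (d + b) % m) , ∈-shifts⁺ (m%n<n _ m) (m%n<n _ m) ,
      trans (act-compose m c d a b σ) (act-% (↭⇒IsPerm σ↭) (c + a) (d + b))

    shifts-free : ∀ {σ} → M σ → Unique (map (λ e → act m e σ) shifts)
    shifts-free {σ} Mσ@(σ↭ , _) =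
      Unique-mapOn⁺ act-injective (Uniqueₚ.cartesianProduct⁺ (Uniqueₚ.upTo⁺ m) (Uniqueₚ.upTo⁺ m))
      where
      act-injective : ∀ {e e′} → e ∈ shifts → e′ ∈ shifts → act m e σ ≡ act m e′ σ → e ≡ e′
      act-injective {a , b} {a′ , b′} e∈ e′∈ same
        with a<m , b<m ← ∈-shifts⁻ e∈ | a′<m , b′<m ← ∈-shifts⁻ e′∈ = cong₂ _,_
          ([m∸a′+a]%m≡0⇒a≡a′ a<m a′<m (trans (sym ([x%m+a]%m≡[x+a]%m (m ∸ a′) a<m)) (proj₁ trivial)))
          ([m∸a′+a]%m≡0⇒a≡a′ b<m b′<m (trans (sym ([x%m+a]%m≡[x+a]%m (m ∸ b′) b<m)) (proj₂ trivial)))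
        where
        σ-perm : IsPerm m σ
        σ-perm = ↭⇒IsPerm σ↭
        x′ y′ : ℕ
        x′ = (m ∸ a′) % m
        y′ = (m ∸ b′) % m
        fixed : act m ((x′ + a) % m , (y′ + b) % m) σ ≡ σ
        fixed = trans (sym (act-% σ-perm (x′ + a) (y′ + b)))
          (trans (sym (act-compose m x′ y′ a b σ)) (trans (cong (act m (x′ , y′)) same) (inverse-act σ-perm a′<m b′<m)))
        trivial : (x′ + a) % m ≡ 0 × (y′ + b) % m ≡ 0
        trivial = stabilizer-trivial Mσ (m%n<n _ m) (m%n<n _ m) fixed

  open FreeAction (≡-dec _≟_) shifts (act m) M shifts-identity shifts-inverse shifts-compose shifts-free
    using (length-divisible)

  IsContraction : List ℕ → Set
  IsContraction σ = ∃[ π ] π ↭ oneToN (2 * n) × MaxSP n π × countContexts π ≡ k × contraction n π ≡ σ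

  private
    ≢2n? : ∀ x → Dec (¬ x ≡ 2 * n)
    ≢2n? x = ¬? (x ≟ 2 * n)

    contraction-expanded : ∀ A B → All (_≢ suc m) A → All (_≢ suc m) B → contraction n (A ++ suc m ∷ 1 ∷ B) ≡ A ++ 1 ∷ B
    contraction-expanded A B A≢ B≢ = begin
      filter ≢2n? (A ++ suc m ∷ 1 ∷ B)       ≡⟨ filter-++ ≢2n? A (suc m ∷ 1 ∷ B) ⟩
      filter ≢2n? A ++ filter ≢2n? (suc m ∷ 1 ∷ B)
        ≡⟨ cong₂ _++_ (filter-all ≢2n? (All.map (λ ≢ e → ≢ (trans e 2n≡1+m)) A≢))
                      (filter-reject ≢2n? (λ ≢ → ≢ (sym 2n≡1+m))) ⟩
      A ++ filter ≢2n? (1 ∷ B)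
        ≡⟨ cong (A ++_) (filter-accept ≢2n? (λ e → <-irrefl (suc-injective (trans e 2n≡1+m)) 1≤m)) ⟩
      A ++ 1 ∷ filter ≢2n? B
        ≡⟨ cong (λ C → A ++ 1 ∷ C) (filter-all ≢2n? (All.map (λ ≢ e → ≢ (trans e 2n≡1+m)) B≢)) ⟩
      A ++ 1 ∷ B                             ∎
      where open ≡-Reasoning

    contraction-oneToN : filter ≢2n? (oneToN (2 * n)) ≡ oneToN m
    contraction-oneToN = begin
      filter ≢2n? (oneToN (2 * n))              ≡⟨ cong (filter ≢2n?) (trans (cong oneToN 2n≡1+m) (oneToN-suc m)) ⟩
      filter ≢2n? (oneToN m ++ suc m ∷ [])      ≡⟨ filter-++ ≢2n? (oneToN m) (suc m ∷ []) ⟩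
      filter ≢2n? (oneToN m) ++ filter ≢2n? (suc m ∷ [])
        ≡⟨ cong₂ _++_ (filter-all ≢2n? (All.tabulate (λ x∈ e → <-irrefl (trans e 2n≡1+m) (s≤s (proj₂ (∈-oneToN⁻ x∈))))))
                      (filter-reject ≢2n? (λ ≢ → ≢ (sym 2n≡1+m))) ⟩
      oneToN m ++ []                            ≡⟨ ++-identityʳ (oneToN m) ⟩
      oneToN m                                  ∎
      where open ≡-Reasoning

    below-2n : ∀ {σ} → IsPerm m σ → All (_≢ suc m) σ
    below-2n σ-perm = All.tabulate (λ x∈ e → <-irrefl e (s≤s (proj₂ (bounded σ-perm x∈))))

  M⇒IsContraction : ∀ {σ} → M σ → IsContraction σ
  M⇒IsContraction {σ} (σ↭ , pile , contexts) with A , B , refl ← IsPerm-split (↭⇒IsPerm σ↭) 1≤m =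
    expand m (A ++ 1 ∷ B) , expanded↭ , pile , contexts ,
    trans (cong (contraction n) expand≡) (contraction-expanded A B (Allₚ.++⁻ˡ A <2n) (All.tail (Allₚ.++⁻ʳ A <2n)))
    where
    σ-perm : IsPerm m (A ++ 1 ∷ B)
    σ-perm = ↭⇒IsPerm σ↭
    expand≡ : expand m (A ++ 1 ∷ B) ≡ A ++ suc m ∷ 1 ∷ B
    expand≡ = expand-split m A B (unique σ-perm)
    <2n : All (_≢ suc m) (A ++ 1 ∷ B)
    <2n = below-2n σ-perm
    expanded↭ : expand m (A ++ 1 ∷ B) ↭ oneToN (2 * n)
    expanded↭ = begin
      expand m (A ++ 1 ∷ B)    ≡⟨ expand≡ ⟩
      A ++ suc m ∷ 1 ∷ B       ↭⟨ shift (suc m) A (1 ∷ B) ⟩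
      suc m ∷ A ++ 1 ∷ B       ↭⟨ prep (suc m) σ↭ ⟩
      suc m ∷ oneToN m         ↭⟨ ∷↭∷ʳ (suc m) (oneToN m) ⟩
      oneToN m ++ suc m ∷ []   ≡⟨ trans (cong oneToN 2n≡1+m) (oneToN-suc m) ⟨
      oneToN (2 * n)           ∎
      where open PermutationReasoning

  private
    expanded⇒M : ∀ A B → A ++ suc m ∷ 1 ∷ B ↭ oneToN (2 * n) → MaxSP n (A ++ suc m ∷ 1 ∷ B) →
      countContexts (A ++ suc m ∷ 1 ∷ B) ≡ k → M (contraction n (A ++ suc m ∷ 1 ∷ B))
    expanded⇒M A B π↭ pile contexts = subst M (sym contraction≡)
      ( σ↭
      , subst (λ τ → length (strategicPile τ) ≡ m) (sym expand≡) pile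
      , subst (λ τ → countContexts τ ≡ k) (sym expand≡) contexts )
      where
      π! : Unique (A ++ suc m ∷ 1 ∷ B)
      π! = unique (↭⇒IsPerm (subst (λ N → A ++ suc m ∷ 1 ∷ B ↭ oneToN N) 2n≡1+m π↭))
      contraction≡ : contraction n (A ++ suc m ∷ 1 ∷ B) ≡ A ++ 1 ∷ B
      contraction≡ = contraction-expanded A B (proj₁ (Unique-middle {xs = A} π!))
                                              (All.tail (proj₂ (Unique-middle {xs = A} π!)))
      σ↭ : A ++ 1 ∷ B ↭ oneToN m
      σ↭ = subst (_↭ oneToN m) contraction≡ (↭-trans (filter-↭ ≢2n? π↭) (↭-reflexive contraction-oneToN))
      expand≡ : expand m (A ++ 1 ∷ B) ≡ A ++ suc m ∷ 1 ∷ B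
      expand≡ = expand-split m A B (unique (↭⇒IsPerm σ↭))

  IsContraction⇒M : ∀ {σ} → IsContraction σ → M σ
  IsContraction⇒M (π , π↭ , pile , contexts , refl)
    with A , B , refl ← maxPile⇒adjacent (↭⇒IsPerm (subst (λ N → π ↭ oneToN N) 2n≡1+m π↭)) 1≤m pile =
    expanded⇒M A B π↭ pile contexts

  private
    M? : ∀ σ → Dec (length (strategicPile (expand m σ)) ≡ m × countContexts (expand m σ) ≡ k)
    M? σ = (length (strategicPile (expand m σ)) ≟ m) ×-dec (countContexts (expand m σ) ≟ k)

    candidates : List (List ℕ)
    candidates = filter M? (permutations (oneToN m))

  enumeration : List (List ℕ)
  enumeration = deduplicate (≡-dec _≟_) candidates

  enumeration! : Unique enumeration
  enumeration! = UniqueDec.deduplicate-! (≡-dec _≟_) candidates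

  ∈-enumeration⁻ : ∀ {σ} → σ ∈ enumeration → M σ
  ∈-enumeration⁻ σ∈ with σ∈perms , Mσ ← ∈-filter⁻ M? (∈-deduplicate⁻ (≡-dec _≟_) candidates σ∈) =
    ∈-permutations⁻ (oneToN m) σ∈perms , Mσ

  ∈-enumeration⁺ : ∀ {σ} → M σ → σ ∈ enumeration
  ∈-enumeration⁺ (σ↭ , Mσ) = ∈-deduplicate⁺ (≡-dec _≟_) (∈-filter⁺ M? (∈-permutations⁺ (oneToN m) σ↭) Mσ)

  m²∣length-enumeration : m ^ 2 ∣ length enumeration
  m²∣length-enumeration = subst (_∣ length enumeration) length-shifts
    (length-divisible M (λ Mσ → Mσ) (λ {_} {e} Mσ _ → M-act (proj₁ e) (proj₂ e) Mσ)
      enumeration enumeration! ∈-enumeration⁻ ∈-enumeration⁺)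
    where
    length-shifts : length shifts ≡ m ^ 2
    length-shifts = trans (length-cartesianProduct (upTo m) (upTo m))
      (trans (cong₂ _*_ (length-upTo m) (length-upTo m)) (cong (m *_) (sym (*-identityʳ m))))

corollary4p6 : (n k : ℕ) → n ≥ 2 → k ≥ 1 → Coprime k (2 * n ∸ 1) →
    Σ (List (List ℕ)) λ L → Unique L
      × ((σ : List ℕ) → (σ ∈ L) ⇔
           (Σ (List ℕ) λ π → π ↭ oneToN (2 * n) × MaxSP n π
              × countContexts π ≡ k × contraction n π ≡ σ))
      × ((2 * n ∸ 1) ^ 2 ∣ length L)
-- The hypothesis k ≥ 1 is implied by coprimality with m ≥ 3.
corollary4p6 n k n≥2 _ k⊥m =
  enumeration , enumeration! ,
  (λ σ → mk⇔ (M⇒IsContraction ∘ ∈-enumeration⁻) (∈-enumeration⁺ ∘ IsContraction⇒M)) ,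
  m²∣length-enumeration
  where open Corollary n k n≥2 k⊥m
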